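{- Equipped with $\mathrm{der}_X=\{([a],a)\mid a\in|X|\}$, $\mathrm{dig}_X=\{(m_1+\dots+m_n,[m_1,\dots,m_n])\mid m_i\in\mathcal M_{\mathrm{fin}}(|X|)\}$, $m^0=\{(*,[])\}\subseteq|1|\times|!\top|$ and $m^2_{X_1,X_2}=\{(([a_1,\dots,a_k],[b_1,\dots,b_l]),[(1,a_1),\dots,(1,a_k),(2,b_1),\dots,(2,b_l)])\}\subseteq|!X_1\otimes!X_2|\times|!(X_1\&X_2)|$, the functor $!$ (with $!t=\{([a_1,\dots,a_n],[b_1,\dots,b_n])\mid (a_i,b_i)\in t\}$) is a comonad on $\mathbf{NUTS}$ with a strong symmetric monoidal structure from $(\mathbf{NUTS},\&,\top)$ to $(\mathbf{NUTS},\otimes,1)$, which turns $\mathbf{NUTS}$ into a Seely category (a Seely model of linear logic).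
   Context: For $\mathcal T\subseteq\mathcal P(E)$, $\mathcal T^\perp=\{u'\subseteq E\mid\forall u\in\mathcal T,\ u\cap u'\neq\emptyset\}$. A NUTS is $X=(|X|,\mathcal T(X))$ with $\mathcal T(X)\subseteq\mathcal P(|X|)$ and $\mathcal T(X)=\mathcal T(X)^{\perp\perp}$. $X^\perp=(|X|,\mathcal T(X)^\perp)$; $X\otimes Y=(|X|\times|Y|,\{u\times v\mid u\in\mathcal T(X),v\in\mathcal T(Y)\}^{\perp\perp})$; $X\multimap Y=(X\otimes Y^\perp)^\perp$; $1=\bot=(\{*\},\{\{*\}\})$; $\top=(\emptyset,\{\emptyset\})$; $X_1\&X_2=(\{1\}\times|X_1|\cup\{2\}\times|X_2|,\{u\mid\pi_i\cdot u\in\mathcal T(X_i),i=1,2\})$ with $\pi_i=\{((i,a),a)\}$; $!X=(\mathcal M_{\mathrm{fin}}(|X|),\{\mathcal M_{\mathrm{fin}}(u)\mid u\in\mathcal T(X)\}^{\perp\perp})$ where $\mathcal M_{\mathrm{fin}}(E)$ is the set of finite multisets on $E$. $\mathbf{NUTS}$ is the category with $\mathbf{NUTS}(X,Y)=\mathcal T(X\multimap Y)$, relational composition and diagonal identities; it is symmetric monoidal closed and $*$-autonomous (dualizing object $\bot$) with the symmetric monoidal isomorphisms, evaluation and currying of $\mathbf{REL}$, and cartesian with product $\&$ and terminal object $\top$. For $t\subseteq E\times F$, $u\subseteq E$: $t\cdot u=\{b\mid\exists a\in u,(a,b)\in t\}$. A Seely category is a symmetric monoidal closed $*$-autonomous cartesian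 category with a comonad $!$ (counit $\mathrm{der}$, comultiplication $\mathrm{dig}$) and a strong symmetric monoidal structure $(m^0,m^2)$ for $!$ from $(\&,\top)$ to $(\otimes,1)$ compatible with $\mathrm{dig}$, as in Melliès' survey of categorical semantics of linear logic. -}

module Defs where

open import Level using (0ℓ) renaming (suc to lsuc)
open import Relation.Binary.Bundles using (Setoid)
open import Relation.Binary.PropositionalEquality as P using (_≡_)
open import Data.Product using (Σ; ∃; _×_; _,_; proj₁; proj₂)
open import Data.Product.Relation.Binary.Pointwise.NonDependent using (×-setoid)
open import Data.Sum using (_⊎_; inj₁; inj₂)
open import Data.Sum.Relation.Binary.Pointwise using (⊎-setoid)
open import Data.Unit using (⊤; tt)
open import Data.Empty using (⊥)
open import Data.List using (List; []; _∷_; _++_; map; concat)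
open import Data.List.Relation.Unary.All using (All)
open import Data.List.Relation.Binary.Pointwise using (Pointwise)
import Data.List.Relation.Binary.Permutation.Setoid as Perm

-- Webs are setoids (Bishop sets).  This is needed because the web of !X
-- is the set of *finite multisets*, represented as lists up to
-- permutation (Perm.↭-setoid), and Agda has no quotient types.

Web : Set₁
Web = Setoid 0ℓ 0ℓ

∣_∣ : Web → Set
∣ A ∣ = Setoid.Carrier A

record Sub (A : Web) : Set₁ where
  field
    mem  : ∣ A ∣ → Set
    resp : ∀ {x y} → Setoid._≈_ A x y → mem x → mem y
open Sub public

_≐_ : {A : Web} → Sub A → Sub A → Set
_≐_ {A} u v = ∀ (x : ∣ A ∣) → (mem u x → mem v x) × (mem v x → mem u x)

-- the subset described by a raw predicate (saturated w.r.t. the setoid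
-- equality; for predicates already closed under it this is the same set)
⟪_⟫ : {A : Web} → (∣ A ∣ → Set) → Sub A
⟪_⟫ {A} P = record
  { mem  = λ x → ∃ λ y → Setoid._≈_ A x y × P y
  ; resp = λ x≈x' h →
      proj₁ h , Setoid.trans A (Setoid.sym A x≈x') (proj₁ (proj₂ h)) , proj₂ (proj₂ h) }

_×w_ : Web → Web → Web
A ×w B = ×-setoid A B

_⊎w_ : Web → Web → Web
A ⊎w B = ⊎-setoid A B

unitW : Web
unitW = P.setoid ⊤

emptyW : Web
emptyW = P.setoid ⊥

MfinW : Web → Web
MfinW A = Perm.↭-setoid A

_ᗮ : {A : Web} → (Sub A → Set₁) → (Sub A → Set₁)
_ᗮ {A} T u' = ∀ (u : Sub A) → T u → ∃ λ (a : ∣ A ∣) → mem u a × mem u' a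

record PreNUTS : Set₂ where
  field
    web : Web
    tot : Sub web → Set₁
open PreNUTS public

IsNUTS : PreNUTS → Set₁
IsNUTS X = ∀ (u : Sub (web X)) →
  (tot X u → ((tot X ᗮ) ᗮ) u) × (((tot X ᗮ) ᗮ) u → tot X u)

NUTS : Set₂
NUTS = Σ PreNUTS IsNUTS

_⊠_ : {A B : Web} → Sub A → Sub B → Sub (A ×w B)
_⊠_ {A} {B} u v = record
  { mem  = λ p → mem u (proj₁ p) × mem v (proj₂ p)
  ; resp = λ e m → resp u (proj₁ e) (proj₁ m) , resp v (proj₂ e) (proj₂ m) }

Mfin : {A : Web} → Sub A → Sub (MfinW A)
Mfin {A} u = ⟪ (λ l → All (mem u) l) ⟫

π₁· : {A B : Web} → Sub (A ⊎w B) → Sub A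
π₁· u = record { mem = λ a → mem u (inj₁ a)
               ; resp = λ e → resp u (Data.Sum.Relation.Binary.Pointwise.inj₁ e) }

π₂· : {A B : Web} → Sub (A ⊎w B) → Sub B
π₂· u = record { mem = λ b → mem u (inj₂ b)
               ; resp = λ e → resp u (Data.Sum.Relation.Binary.Pointwise.inj₂ e) }

_^⊥ : PreNUTS → PreNUTS
X ^⊥ = record { web = web X ; tot = tot X ᗮ }

_⊗_ : PreNUTS → PreNUTS → PreNUTS
X ⊗ Y = record
  { web = web X ×w web Y
  ; tot = (gen ᗮ) ᗮ }
  where
  gen : Sub (web X ×w web Y) → Set₁
  gen w = Σ (Sub (web X)) λ u → Σ (Sub (web Y)) λ v →
            tot X u × tot Y v × (w ≐ (u ⊠ v))

_⊸_ : PreNUTS → PreNUTS → PreNUTS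
X ⊸ Y = (X ⊗ (Y ^⊥)) ^⊥

𝟏 : PreNUTS
𝟏 = record { web = unitW ; tot = λ u → Level.Lift (lsuc 0ℓ) (mem u tt) }

𝟏⊥ : PreNUTS
𝟏⊥ = 𝟏

⊤N : PreNUTS
⊤N = record { web = emptyW ; tot = λ _ → Level.Lift (lsuc 0ℓ) ⊤ }

_&_ : PreNUTS → PreNUTS → PreNUTS
X & Y = record
  { web = web X ⊎w web Y
  ; tot = λ u → tot X (π₁· u) × tot Y (π₂· u) }

! : PreNUTS → PreNUTS
! X = record { web = MfinW (web X) ; tot = (gen ᗮ) ᗮ }
  where
  gen : Sub (MfinW (web X)) → Set₁
  gen w = Σ (Sub (web X)) λ u → tot X u × (w ≐ Mfin u)

-- a relation t ⊆ |X| × |Y|  (wrapped so that X and Y are inferable)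
record Rel (X Y : PreNUTS) : Set₁ where
  constructor rel
  field rsub : Sub (web X ×w web Y)
open Rel public

_∋_ : {X Y : PreNUTS} → Rel X Y → ∣ web X ×w web Y ∣ → Set
t ∋ p = mem (rsub t) p

_≗_ : {X Y : PreNUTS} → Rel X Y → Rel X Y → Set
s ≗ t = rsub s ≐ rsub t
infix 4 _≗_

Hom : (X Y : PreNUTS) → Rel X Y → Set₁
Hom X Y t = tot (X ⊸ Y) (rsub t)

idR : (X : PreNUTS) → Rel X X
idR X = rel ⟪ (λ p → proj₁ p ≡ proj₂ p) ⟫

-- relational composition, diagrammatic order:  s ⨾ t = t ∘ s
_⨾_ : {X Y Z : PreNUTS} → Rel X Y → Rel Y Z → Rel X Z
_⨾_ {Y = Y} s t = rel ⟪ (λ p → ∃ λ (b : ∣ web Y ∣) →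
                       s ∋ (proj₁ p , b) × t ∋ (b , proj₂ p)) ⟫
infixl 5 _⨾_

_⊗R_ : {X X' Y Y' : PreNUTS} → Rel X X' → Rel Y Y' → Rel (X ⊗ Y) (X' ⊗ Y')
s ⊗R t = rel ⟪ (λ p → s ∋ (proj₁ (proj₁ p) , proj₁ (proj₂ p))
                 × t ∋ (proj₂ (proj₁ p) , proj₂ (proj₂ p))) ⟫

π₁ : {X Y : PreNUTS} → Rel (X & Y) X
π₁ = rel ⟪ (λ { (inj₁ a , a') → a ≡ a' ; (inj₂ _ , _) → ⊥ }) ⟫

π₂ : {X Y : PreNUTS} → Rel (X & Y) Y
π₂ = rel ⟪ (λ { (inj₂ b , b') → b ≡ b' ; (inj₁ _ , _) → ⊥ }) ⟫

⟨_,_⟩ : {Z X Y : PreNUTS} → Rel Z X → Rel Z Y → Rel Z (X & Y)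
⟨ f , g ⟩ = rel ⟪ (λ { (c , inj₁ a) → f ∋ (c , a) ; (c , inj₂ b) → g ∋ (c , b) }) ⟫

_&R_ : {X X' Y Y' : PreNUTS} → Rel X X' → Rel Y Y' → Rel (X & Y) (X' & Y')
_&R_ {X} {X'} {Y} {Y'} s t = ⟨ π₁ {X} {Y} ⨾ s , π₂ {X} {Y} ⨾ t ⟩

α& : (X Y Z : PreNUTS) → Rel ((X & Y) & Z) (X & (Y & Z))
α& X Y Z = ⟨ π₁ {X & Y} {Z} ⨾ π₁ {X} {Y}
           , ⟨ π₁ {X & Y} {Z} ⨾ π₂ {X} {Y} , π₂ {X & Y} {Z} ⟩ ⟩

λ& : (X : PreNUTS) → Rel (⊤N & X) X
λ& X = π₂ {⊤N} {X}

ρ& : (X : PreNUTS) → Rel (X & ⊤N) X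
ρ& X = π₁ {X} {⊤N}

σ& : (X Y : PreNUTS) → Rel (X & Y) (Y & X)
σ& X Y = ⟨ π₂ {X} {Y} , π₁ {X} {Y} ⟩

α⊗ : (X Y Z : PreNUTS) → Rel ((X ⊗ Y) ⊗ Z) (X ⊗ (Y ⊗ Z))
α⊗ X Y Z = rel ⟪ (λ { (((a , b) , c) , (a' , (b' , c'))) → a ≡ a' × b ≡ b' × c ≡ c' }) ⟫

λ⊗ : (X : PreNUTS) → Rel (𝟏 ⊗ X) X
λ⊗ X = rel ⟪ (λ { ((_ , a) , a') → a ≡ a' }) ⟫

ρ⊗ : (X : PreNUTS) → Rel (X ⊗ 𝟏) X
ρ⊗ X = rel ⟪ (λ { ((a , _) , a') → a ≡ a' }) ⟫

σ⊗ : (X Y : PreNUTS) → Rel (X ⊗ Y) (Y ⊗ X)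
σ⊗ X Y = rel ⟪ (λ { ((a , b) , (b' , a')) → a ≡ a' × b ≡ b' }) ⟫

!R : {X Y : PreNUTS} → Rel X Y → Rel (! X) (! Y)
!R t = rel ⟪ (λ p → Pointwise (λ a b → t ∋ (a , b)) (proj₁ p) (proj₂ p)) ⟫

der : (X : PreNUTS) → Rel (! X) X
der X = rel ⟪ (λ p → proj₁ p ≡ proj₂ p ∷ []) ⟫

dig : (X : PreNUTS) → Rel (! X) (! (! X))
dig X = rel ⟪ (λ p → proj₁ p ≡ concat (proj₂ p)) ⟫

m⁰ : Rel 𝟏 (! ⊤N)
m⁰ = rel ⟪ (λ p → proj₂ p ≡ []) ⟫

m² : (X Y : PreNUTS) → Rel (! X ⊗ ! Y) (! (X & Y))
m² X Y = rel ⟪ (λ { ((l₁ , l₂) , l) → l ≡ map inj₁ l₁ ++ map inj₂ l₂ }) ⟫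

IsIso : (X Y : PreNUTS) → Rel X Y → Set₁
IsIso X Y f = Σ (Rel Y X) λ g →
  Hom Y X g × ((f ⨾ g) ≗ idR X) × ((g ⨾ f) ≗ idR Y)

record SeelyStructure : Set₃ where
  field
    !-hom  : (X Y : NUTS) (t : Rel (proj₁ X) (proj₁ Y)) →
             Hom (proj₁ X) (proj₁ Y) t → Hom (! (proj₁ X)) (! (proj₁ Y)) (!R t)
    !-id   : (X : NUTS) → !R (idR (proj₁ X)) ≗ idR (! (proj₁ X))
    !-comp : (X Y Z : NUTS) (s : Rel (proj₁ X) (proj₁ Y)) (t : Rel (proj₁ Y) (proj₁ Z)) →
             Hom (proj₁ X) (proj₁ Y) s → Hom (proj₁ Y) (proj₁ Z) t →
             !R (s ⨾ t) ≗ (!R s ⨾ !R t)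
    der-hom : (X : NUTS) → Hom (! (proj₁ X)) (proj₁ X) (der (proj₁ X))
    dig-hom : (X : NUTS) → Hom (! (proj₁ X)) (! (! (proj₁ X))) (dig (proj₁ X))
    der-nat : (X Y : NUTS) (t : Rel (proj₁ X) (proj₁ Y)) → Hom (proj₁ X) (proj₁ Y) t →
              (!R t ⨾ der (proj₁ Y)) ≗ (der (proj₁ X) ⨾ t)
    dig-nat : (X Y : NUTS) (t : Rel (proj₁ X) (proj₁ Y)) → Hom (proj₁ X) (proj₁ Y) t →
              (!R t ⨾ dig (proj₁ Y)) ≗ (dig (proj₁ X) ⨾ !R (!R t))
    comonad-der₁ : (X : NUTS) → (dig (proj₁ X) ⨾ der (! (proj₁ X))) ≗ idR (! (proj₁ X))
    comonad-der₂ : (X : NUTS) → (dig (proj₁ X) ⨾ !R (der (proj₁ X))) ≗ idR (! (proj₁ X))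
    comonad-dig  : (X : NUTS) →
                   (dig (proj₁ X) ⨾ dig (! (proj₁ X))) ≗ (dig (proj₁ X) ⨾ !R (dig (proj₁ X)))
    m⁰-hom : Hom 𝟏 (! ⊤N) m⁰
    m⁰-iso : IsIso 𝟏 (! ⊤N) m⁰
    m²-hom : (X Y : NUTS) →
             Hom (! (proj₁ X) ⊗ ! (proj₁ Y)) (! (proj₁ X & proj₁ Y)) (m² (proj₁ X) (proj₁ Y))
    m²-iso : (X Y : NUTS) →
             IsIso (! (proj₁ X) ⊗ ! (proj₁ Y)) (! (proj₁ X & proj₁ Y)) (m² (proj₁ X) (proj₁ Y))
    m²-nat : (X X' Y Y' : NUTS) (s : Rel (proj₁ X) (proj₁ X')) (t : Rel (proj₁ Y) (proj₁ Y')) →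
             Hom (proj₁ X) (proj₁ X') s → Hom (proj₁ Y) (proj₁ Y') t →
             (_⊗R_ { ! (proj₁ X)} { ! (proj₁ X')} { ! (proj₁ Y)} { ! (proj₁ Y')} (!R s) (!R t)
               ⨾ m² (proj₁ X') (proj₁ Y'))
             ≗ (m² (proj₁ X) (proj₁ Y)
               ⨾ !R (_&R_ {proj₁ X} {proj₁ X'} {proj₁ Y} {proj₁ Y'} s t))
    m²-assoc : (X Y Z : NUTS) →
      let A = proj₁ X ; B = proj₁ Y ; C = proj₁ Z in
      (α⊗ (! A) (! B) (! C)
        ⨾ _⊗R_ { ! A} { ! A} { ! B ⊗ ! C} { ! (B & C)} (idR (! A)) (m² B C)
        ⨾ m² A (B & C))
      ≗ (_⊗R_ { ! A ⊗ ! B} { ! (A & B)} { ! C} { ! C} (m² A B) (idR (! C))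
        ⨾ m² (A & B) C
        ⨾ !R (α& A B C))
    m²-unitˡ : (X : NUTS) → let A = proj₁ X in
      (_⊗R_ {𝟏} { ! ⊤N} { ! A} { ! A} m⁰ (idR (! A)) ⨾ m² ⊤N A ⨾ !R (λ& A))
      ≗ λ⊗ (! A)
    m²-unitʳ : (X : NUTS) → let A = proj₁ X in
      (_⊗R_ { ! A} { ! A} {𝟏} { ! ⊤N} (idR (! A)) m⁰ ⨾ m² A ⊤N ⨾ !R (ρ& A))
      ≗ ρ⊗ (! A)
    m²-sym : (X Y : NUTS) → let A = proj₁ X ; B = proj₁ Y in
      (m² A B ⨾ !R (σ& A B)) ≗ (σ⊗ (! A) (! B) ⨾ m² B A)
    seely-dig : (X Y : NUTS) → let A = proj₁ X ; B = proj₁ Y in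
      (m² A B ⨾ dig (A & B)
        ⨾ !R (⟨_,_⟩ { ! (A & B)} { ! A} { ! B} (!R (π₁ {A} {B})) (!R (π₂ {A} {B}))))
      ≗ (_⊗R_ { ! A} { ! (! A)} { ! B} { ! (! B)} (dig A) (dig B) ⨾ m² (! A) (! B))

-- All the structure maps are relations, and every equation between them holds already in the
-- relational model; it is checked elementwise, finite multisets being lists up to permutation.
-- What is specific to NUTS is that !t, der, dig, m⁰, m² and the inverses of m⁰, m² are morphisms.
-- Since T(!X) and T(X ⊗ Y) are biorthogonal closures of the sets M_fin(u) and u × v, a relation
-- t ⊆ |X| × |Y| is a morphism as soon as it meets u × v' for every generator u of T(X) and every
-- v' ∈ T(Y)^⊥: the preimage t⁻¹·v' is then orthogonal to the generators, hence to all of T(X).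
-- For !t this reduces to t·u ∈ T(Y) for u ∈ T(X); for m² the same argument is run in each factor
-- of the tensor.

module Submission where

open import Defs
open import Level using (lift)
open import Data.Unit using (⊤; tt)
open import Data.Empty using (⊥)
open import Relation.Binary.Bundles using (Setoid)
open import Relation.Binary.PropositionalEquality as P using (_≡_; refl)
open import Data.Product using (∃; _×_; _,_; proj₁; proj₂)
open import Data.Sum using (_⊎_; inj₁; inj₂; swap; assocˡ; assocʳ; [_,_]′)
import Data.Sum.Relation.Binary.Pointwise as ⊎ₚ
open import Data.Sum.Properties using (swap-involutive)
open import Data.List using (List; []; _∷_; _++_; map; concat)
open import Data.List.Properties using (concat-map-[_]; concat-concat; concat-map; concat-++; map-++; map-∘)
open import Data.List.Relation.Unary.All using (All; []; _∷_)
import Data.List.Relation.Unary.All.Properties as Allₚ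
open import Data.List.Relation.Binary.Pointwise as PW using (Pointwise; []; _∷_)
open import Relation.Binary.Definitions using (_Respectsˡ_; _Respectsʳ_)
import Data.List.Relation.Binary.Permutation.Setoid as Perm
import Data.List.Relation.Binary.Permutation.Setoid.Properties as Permₚ
import Data.List.Relation.Binary.Permutation.Homogeneous as H

-- Orthogonality and morphisms

_≬_ : {A : Web} → Sub A → Sub A → Set
_≬_ {A} u v = ∃ λ (a : ∣ A ∣) → mem u a × mem v a

≬-sym : {A : Web} {u v : Sub A} → u ≬ v → v ≬ u
≬-sym (a , ua , va) = a , va , ua

⊆-ᗮᗮ : {A : Web} (T : Sub A → Set₁) (u : Sub A) → T u → ((T ᗮ) ᗮ) u
⊆-ᗮᗮ T u Tu v Tᗮv = ≬-sym {u = u} {v} (Tᗮv u Tu)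

ᗮᗮᗮ⇒ᗮ : {A : Web} (T : Sub A → Set₁) (v : Sub A) → (((T ᗮ) ᗮ) ᗮ) v → (T ᗮ) v
ᗮᗮᗮ⇒ᗮ T v h u Tu = h u (⊆-ᗮᗮ T u Tu)

tot-resp-≐ : (X : NUTS) {u v : Sub (web (proj₁ X))} → u ≐ v → tot (proj₁ X) u → tot (proj₁ X) v
tot-resp-≐ (X , nuts) {u} {v} u≐v Tu = proj₂ (nuts v) λ w Tᗮw →
  let (a , wa , ua) = proj₁ (nuts u) Tu w Tᗮw in a , wa , proj₁ (u≐v a) ua

⊗-generators : (X Y : PreNUTS) → Sub (web X ×w web Y) → Set₁
⊗-generators X Y w = ∃ λ u → ∃ λ v → tot X u × tot Y v × (w ≐ (u ⊠ v))

!-generators : (X : PreNUTS) → Sub (MfinW (web X)) → Set₁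
!-generators X w = ∃ λ u → tot X u × (w ≐ Mfin u)

≐-refl : {A : Web} (u : Sub A) → u ≐ u
≐-refl u _ = (λ m → m) , (λ m → m)

_·_ : {A B : Web} → Sub (A ×w B) → Sub A → Sub B
_·_ {A} c u = record
  { mem  = λ b → ∃ λ a → mem u a × mem c (a , b)
  ; resp = λ b≈b' (a , ua , cab) → a , ua , resp c (Setoid.refl A , b≈b') cab }

_⁻¹·_ : {A B : Web} → Sub (A ×w B) → Sub B → Sub A
_⁻¹·_ {B = B} c v = record
  { mem  = λ a → ∃ λ b → mem v b × mem c (a , b)
  ; resp = λ a≈a' (b , vb , cab) → b , vb , resp c (a≈a' , Setoid.refl B) cab }

Hom⁺ : (X Y : PreNUTS) (t : Rel X Y) (G : Sub (web X) → Set₁) →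
       (∀ u → tot X u → ((G ᗮ) ᗮ) u) →
       (∀ w v → G w → (tot Y ᗮ) v → (w ⊠ v) ≬ rsub t) →
       Hom X Y t
Hom⁺ X Y t G tot⊆Gᗮᗮ meets = ⊆-ᗮᗮ (⊗-generators X (Y ^⊥) ᗮ) (rsub t) λ w (u , v , Tu , Tᗮv , w≐u⊠v) →
  let (a , (b , vb , tab) , ua) = tot⊆Gᗮᗮ u Tu (rsub t ⁻¹· v) (λ w' Gw' →
        let ((a , b) , (w'a , vb) , tab) = meets w' v Gw' Tᗮv in a , w'a , b , vb , tab)
  in (a , b) , proj₂ (w≐u⊠v (a , b)) (ua , vb) , tab

Hom⁻ : (X Y : PreNUTS) (t : Rel X Y) → Hom X Y t →
       ∀ u v → tot X u → (tot Y ᗮ) v → (u ⊠ v) ≬ rsub t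
Hom⁻ X Y t h u v Tu Tᗮv =
  ᗮᗮᗮ⇒ᗮ (⊗-generators X (Y ^⊥)) (rsub t) h (u ⊠ v) (u , v , Tu , Tᗮv , ≐-refl (u ⊠ v))

Hom-image : (X Y : NUTS) (t : Rel (proj₁ X) (proj₁ Y)) → Hom (proj₁ X) (proj₁ Y) t →
            ∀ u → tot (proj₁ X) u → tot (proj₁ Y) (rsub t · u)
Hom-image (X , _) (Y , nuts) t h u Tu = proj₂ (nuts (rsub t · u)) λ v Tᗮv →
  let ((a , b) , (ua , vb) , tab) = Hom⁻ X Y t h u v Tu Tᗮv in b , vb , a , ua , tab

⊠-ᗮᗮ-≬ : {A B : Web} (G₁ : Sub A → Set₁) (G₂ : Sub B → Set₁) (c : Sub (A ×w B)) →
         (∀ u₁ u₂ → G₁ u₁ → G₂ u₂ → (u₁ ⊠ u₂) ≬ c) →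
         ∀ {w₁ w₂} → ((G₁ ᗮ) ᗮ) w₁ → ((G₂ ᗮ) ᗮ) w₂ → (w₁ ⊠ w₂) ≬ c
⊠-ᗮᗮ-≬ G₁ G₂ c meets {w₁} {w₂} T₁ T₂ =
  let (a , (b , w₂b , cab) , w₁a) = T₁ (c ⁻¹· w₂) λ u₁ G₁u₁ →
        let (b , (a , u₁a , cab) , w₂b) = T₂ (c · u₁) λ u₂ G₂u₂ →
              let ((a , b) , (u₁a , u₂b) , cab) = meets u₁ u₂ G₁u₁ G₂u₂ in b , u₂b , a , u₁a , cab
        in a , u₁a , b , w₂b , cab
  in (a , b) , (w₁a , w₂b) , cab

-- Lists and finite multisets

module _ {A B : Set} {R : A → B → Set} where

  Pointwise-++⁻ʳ : ∀ {xs} ys₁ ys₂ → Pointwise R xs (ys₁ ++ ys₂) →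
                   ∃ λ xs₁ → ∃ λ xs₂ → xs ≡ xs₁ ++ xs₂ × Pointwise R xs₁ ys₁ × Pointwise R xs₂ ys₂
  Pointwise-++⁻ʳ [] ys₂ pw = [] , _ , refl , [] , pw
  Pointwise-++⁻ʳ (y ∷ ys₁) ys₂ (r ∷ pw) with xs₁ , xs₂ , refl , pw₁ , pw₂ ← Pointwise-++⁻ʳ ys₁ ys₂ pw =
    _ ∷ xs₁ , xs₂ , refl , r ∷ pw₁ , pw₂

  Pointwise-concat⁻ʳ : ∀ {xs} Ys → Pointwise R xs (concat Ys) →
                       ∃ λ Xs → concat Xs ≡ xs × Pointwise (Pointwise R) Xs Ys
  Pointwise-concat⁻ʳ [] [] = [] , refl , []
  Pointwise-concat⁻ʳ (ys ∷ Ys) pw with xs₁ , xs₂ , refl , pw₁ , pw₂ ← Pointwise-++⁻ʳ ys (concat Ys) pw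
    with Xs , refl , pws ← Pointwise-concat⁻ʳ Ys pw₂ = xs₁ ∷ Xs , refl , pw₁ ∷ pws

module _ {A B C : Set} (f : B → C) where

  Pointwise-mapʳ : {R : A → C → Set} {xs : List A} {ys : List B} →
                   Pointwise (λ a b → R a (f b)) xs ys → Pointwise R xs (map f ys)
  Pointwise-mapʳ [] = []
  Pointwise-mapʳ (r ∷ rs) = r ∷ Pointwise-mapʳ rs

  Pointwise-mapˡ : {R : C → A → Set} {xs : List B} {ys : List A} →
                   Pointwise (λ b a → R (f b) a) xs ys → Pointwise R (map f xs) ys
  Pointwise-mapˡ [] = []
  Pointwise-mapˡ (r ∷ rs) = r ∷ Pointwise-mapˡ rs

Pointwise-∃⁻ : {A B C : Set} {S : A → B → Set} {T : B → C → Set} {xs : List A} {zs : List C} →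
               Pointwise (λ a c → ∃ λ b → S a b × T b c) xs zs →
               ∃ λ ys → Pointwise S xs ys × Pointwise T ys zs
Pointwise-∃⁻ [] = [] , [] , []
Pointwise-∃⁻ ((b , s , t) ∷ rs) = let (ys , ss , ts) = Pointwise-∃⁻ rs in b ∷ ys , s ∷ ss , t ∷ ts

_⊕_ : {A B : Set} → List A → List B → List (A ⊎ B)
l₁ ⊕ l₂ = map inj₁ l₁ ++ map inj₂ l₂

lefts : {A B : Set} → List (A ⊎ B) → List A
lefts [] = []
lefts (inj₁ a ∷ l) = a ∷ lefts l
lefts (inj₂ b ∷ l) = lefts l

rights : {A B : Set} → List (A ⊎ B) → List B
rights [] = []
rights (inj₁ a ∷ l) = rights l
rights (inj₂ b ∷ l) = b ∷ rights l

lefts-⊕ : {A B : Set} (l₁ : List A) (l₂ : List B) → lefts (l₁ ⊕ l₂) ≡ l₁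
lefts-⊕ (a ∷ l₁) l₂ = P.cong (a ∷_) (lefts-⊕ l₁ l₂)
lefts-⊕ [] [] = refl
lefts-⊕ [] (b ∷ l₂) = lefts-⊕ [] l₂

rights-⊕ : {A B : Set} (l₁ : List A) (l₂ : List B) → rights (l₁ ⊕ l₂) ≡ l₂
rights-⊕ (a ∷ l₁) l₂ = rights-⊕ l₁ l₂
rights-⊕ [] [] = refl
rights-⊕ [] (b ∷ l₂) = P.cong (b ∷_) (rights-⊕ [] l₂)

module _ {A A' B B' : Set} {R : A → A' → Set} {S : B → B' → Set} where

  Pointwise-⊕ : ∀ {l₁ l₁' l₂ l₂'} → Pointwise R l₁ l₁' → Pointwise S l₂ l₂' →
                Pointwise (⊎ₚ.Pointwise R S) (l₁ ⊕ l₂) (l₁' ⊕ l₂')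
  Pointwise-⊕ pw₁ pw₂ =
    PW.++⁺ (PW.map⁺ inj₁ inj₁ (PW.map ⊎ₚ.inj₁ pw₁)) (PW.map⁺ inj₂ inj₂ (PW.map ⊎ₚ.inj₂ pw₂))

  Pointwise-⊕⁻ˡ : ∀ l₁ l₂ {l'} → Pointwise (⊎ₚ.Pointwise R S) (l₁ ⊕ l₂) l' →
                  ∃ λ l₁' → ∃ λ l₂' → l' ≡ l₁' ⊕ l₂' × Pointwise R l₁ l₁' × Pointwise S l₂ l₂'
  Pointwise-⊕⁻ˡ (a ∷ l₁) l₂ (⊎ₚ.inj₁ r ∷ pw) with l₁' , l₂' , refl , pw₁ , pw₂ ← Pointwise-⊕⁻ˡ l₁ l₂ pw =
    _ ∷ l₁' , l₂' , refl , r ∷ pw₁ , pw₂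
  Pointwise-⊕⁻ˡ [] (b ∷ l₂) (⊎ₚ.inj₂ r ∷ pw) with [] , l₂' , refl , [] , pw₂ ← Pointwise-⊕⁻ˡ [] l₂ pw =
    [] , _ ∷ l₂' , refl , [] , r ∷ pw₂
  Pointwise-⊕⁻ˡ [] [] [] = [] , [] , refl , [] , []

map-retraction : {A B : Set} (f : A → B) (g : B → A) → (∀ x → g (f x) ≡ x) →
                 ∀ xs → map g (map f xs) ≡ xs
map-retraction f g gf≡id [] = refl
map-retraction f g gf≡id (x ∷ xs) = P.cong₂ _∷_ (gf≡id x) (map-retraction f g gf≡id xs)

assocˡ-⊕ : {A B C : Set} (l₁ : List A) (l₂ : List B) (l₃ : List C) →
           map assocˡ (l₁ ⊕ (l₂ ⊕ l₃)) ≡ (l₁ ⊕ l₂) ⊕ l₃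
assocˡ-⊕ (a ∷ l₁) l₂ l₃ = P.cong (_ ∷_) (assocˡ-⊕ l₁ l₂ l₃)
assocˡ-⊕ [] (b ∷ l₂) l₃ = P.cong (_ ∷_) (assocˡ-⊕ [] l₂ l₃)
assocˡ-⊕ [] [] (c ∷ l₃) = P.cong (_ ∷_) (assocˡ-⊕ [] [] l₃)
assocˡ-⊕ [] [] [] = refl

swap-⊕ : {A B : Set} (l₁ : List A) (l₂ : List B) → map swap (l₁ ⊕ l₂) ≡ map inj₂ l₁ ++ map inj₁ l₂
swap-⊕ (a ∷ l₁) l₂ = P.cong (_ ∷_) (swap-⊕ l₁ l₂)
swap-⊕ [] [] = refl
swap-⊕ [] (b ∷ l₂) = P.cong (_ ∷_) (swap-⊕ [] l₂)

embed : {A B : Set} → List A ⊎ List B → List (A ⊎ B)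
embed = [ map inj₁ , map inj₂ ]′

concat-embed-⊕ : {A B : Set} (L₁ : List (List A)) (L₂ : List (List B)) →
                 concat (map embed (L₁ ⊕ L₂)) ≡ concat L₁ ⊕ concat L₂
concat-embed-⊕ L₁ L₂ = begin
  concat (map embed (map inj₁ L₁ ++ map inj₂ L₂))
    ≡⟨ P.cong concat (map-++ embed (map inj₁ L₁) (map inj₂ L₂)) ⟩
  concat (map embed (map inj₁ L₁) ++ map embed (map inj₂ L₂))
    ≡⟨ P.cong₂ (λ K₁ K₂ → concat (K₁ ++ K₂)) (P.sym (map-∘ L₁)) (P.sym (map-∘ L₂)) ⟩
  concat (map (map inj₁) L₁ ++ map (map inj₂) L₂)
    ≡⟨ P.sym (concat-++ (map (map inj₁) L₁) (map (map inj₂) L₂)) ⟩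
  concat (map (map inj₁) L₁) ++ concat (map (map inj₂) L₂)
    ≡⟨ P.cong₂ _++_ (concat-map L₁) (concat-map L₂) ⟩
  concat L₁ ⊕ concat L₂ ∎
  where open P.≡-Reasoning

Permutation : (W : Web) → List ∣ W ∣ → List ∣ W ∣ → Set
Permutation W = Perm._↭_ W

syntax Permutation W xs ys = xs ↭[ W ] ys

module _ (W : Web) where
  open Perm W public using (↭-refl; ↭-sym; ↭-trans; ↭-prep; ↭-swap)

module _ (W : Web) where
  open Setoid W using (_≈_)

  ↭-++ : ∀ {ws xs ys zs} → ws ↭[ W ] xs → ys ↭[ W ] zs → (ws ++ ys) ↭[ W ] (xs ++ zs)
  ↭-++ = Permₚ.++⁺ W

  ↭-concat-Pointwise : ∀ {Ls Ls'} → Pointwise (Permutation W) Ls Ls' → concat Ls ↭[ W ] concat Ls'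
  ↭-concat-Pointwise [] = ↭-refl W
  ↭-concat-Pointwise (p ∷ ps) = ↭-++ p (↭-concat-Pointwise ps)

  ↭-concat : ∀ {Ls Ls'} → Ls ↭[ MfinW W ] Ls' → concat Ls ↭[ W ] concat Ls'
  ↭-concat (H.refl ps) = ↭-concat-Pointwise ps
  ↭-concat (H.prep p q) = ↭-++ p (↭-concat q)
  ↭-concat (H.swap {x′ = L₁} {y′ = L₂} p₁ p₂ q) =
    ↭-trans W (↭-++ p₁ (↭-++ p₂ (↭-concat q))) (Permₚ.shifts W L₁ L₂)
  ↭-concat (H.trans p q) = ↭-trans W (↭-concat p) (↭-concat q)

  ↭-[]⁻ : ∀ {xs} → xs ↭[ W ] [] → xs ≡ []
  ↭-[]⁻ (H.refl []) = refl
  ↭-[]⁻ (H.trans p q) with refl ← ↭-[]⁻ q = ↭-[]⁻ p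

  ↭-[-]⁻ : ∀ {xs b} → xs ↭[ W ] (b ∷ []) → ∃ λ a → xs ≡ a ∷ [] × a ≈ b
  ↭-[-]⁻ (H.refl (a≈b ∷ [])) = _ , refl , a≈b
  ↭-[-]⁻ (H.prep a≈b p) with refl ← ↭-[]⁻ p = _ , refl , a≈b
  ↭-[-]⁻ (H.trans p q) with _ , refl , a'≈b ← ↭-[-]⁻ q =
    let (a , xs≡[a] , a≈a') = ↭-[-]⁻ p in a , xs≡[a] , Setoid.trans W a≈a' a'≈b

module _ (A B : Web) where
  private
    AB : Web
    AB = A ⊎w B

  lefts-↭ : ∀ {xs ys} → xs ↭[ AB ] ys → lefts xs ↭[ A ] lefts ys
  lefts-↭ (H.refl ps) = H.refl (go ps)
    where
    go : ∀ {xs ys} → Pointwise (Setoid._≈_ AB) xs ys → Pointwise (Setoid._≈_ A) (lefts xs) (lefts ys)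
    go [] = []
    go (⊎ₚ.inj₁ e ∷ ps) = e ∷ go ps
    go (⊎ₚ.inj₂ e ∷ ps) = go ps
  lefts-↭ (H.prep (⊎ₚ.inj₁ e) p) = H.prep e (lefts-↭ p)
  lefts-↭ (H.prep (⊎ₚ.inj₂ e) p) = lefts-↭ p
  lefts-↭ (H.swap (⊎ₚ.inj₁ e₁) (⊎ₚ.inj₁ e₂) p) = H.swap e₁ e₂ (lefts-↭ p)
  lefts-↭ (H.swap (⊎ₚ.inj₁ e₁) (⊎ₚ.inj₂ e₂) p) = H.prep e₁ (lefts-↭ p)
  lefts-↭ (H.swap (⊎ₚ.inj₂ e₁) (⊎ₚ.inj₁ e₂) p) = H.prep e₂ (lefts-↭ p)
  lefts-↭ (H.swap (⊎ₚ.inj₂ e₁) (⊎ₚ.inj₂ e₂) p) = lefts-↭ p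
  lefts-↭ (H.trans p q) = H.trans (lefts-↭ p) (lefts-↭ q)

  rights-↭ : ∀ {xs ys} → xs ↭[ AB ] ys → rights xs ↭[ B ] rights ys
  rights-↭ (H.refl ps) = H.refl (go ps)
    where
    go : ∀ {xs ys} → Pointwise (Setoid._≈_ AB) xs ys → Pointwise (Setoid._≈_ B) (rights xs) (rights ys)
    go [] = []
    go (⊎ₚ.inj₁ e ∷ ps) = go ps
    go (⊎ₚ.inj₂ e ∷ ps) = e ∷ go ps
  rights-↭ (H.prep (⊎ₚ.inj₁ e) p) = rights-↭ p
  rights-↭ (H.prep (⊎ₚ.inj₂ e) p) = H.prep e (rights-↭ p)
  rights-↭ (H.swap (⊎ₚ.inj₁ e₁) (⊎ₚ.inj₁ e₂) p) = rights-↭ p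
  rights-↭ (H.swap (⊎ₚ.inj₁ e₁) (⊎ₚ.inj₂ e₂) p) = H.prep e₂ (rights-↭ p)
  rights-↭ (H.swap (⊎ₚ.inj₂ e₁) (⊎ₚ.inj₁ e₂) p) = H.prep e₁ (rights-↭ p)
  rights-↭ (H.swap (⊎ₚ.inj₂ e₁) (⊎ₚ.inj₂ e₂) p) = H.swap e₁ e₂ (rights-↭ p)
  rights-↭ (H.trans p q) = H.trans (rights-↭ p) (rights-↭ q)

  ⊕-↭ : ∀ {l₁ l₂ k₁ k₂} → l₁ ↭[ A ] k₁ → l₂ ↭[ B ] k₂ → (l₁ ⊕ l₂) ↭[ AB ] (k₁ ⊕ k₂)
  ⊕-↭ p q = ↭-++ AB (Permₚ.map⁺ A AB ⊎ₚ.inj₁ p) (Permₚ.map⁺ B AB ⊎ₚ.inj₂ q)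

  ⊕-↭⁻ : ∀ {l₁ l₂ k₁ k₂} → (l₁ ⊕ l₂) ↭[ AB ] (k₁ ⊕ k₂) → l₁ ↭[ A ] k₁ × l₂ ↭[ B ] k₂
  ⊕-↭⁻ {l₁} {l₂} {k₁} {k₂} p =
    P.subst₂ (Permutation A) (lefts-⊕ l₁ l₂) (lefts-⊕ k₁ k₂) (lefts-↭ p) ,
    P.subst₂ (Permutation B) (rights-⊕ l₁ l₂) (rights-⊕ k₁ k₂) (rights-↭ p)

  swap-⊕-↭ : ∀ l₁ l₂ → map swap (l₂ ⊕ l₁) ↭[ AB ] (l₁ ⊕ l₂)
  swap-⊕-↭ l₁ l₂ = P.subst (λ xs → xs ↭[ AB ] (l₁ ⊕ l₂)) (P.sym (swap-⊕ l₂ l₁))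
                     (Permₚ.++-comm AB (map inj₂ l₂) (map inj₁ l₁))

  ↭-lefts⊕rights : ∀ xs → xs ↭[ AB ] (lefts xs ⊕ rights xs)
  ↭-lefts⊕rights [] = ↭-refl AB
  ↭-lefts⊕rights (inj₁ a ∷ xs) = ↭-prep AB _ (↭-lefts⊕rights xs)
  ↭-lefts⊕rights (inj₂ b ∷ xs) =
    ↭-trans AB (↭-prep AB _ (↭-lefts⊕rights xs)) (↭-sym AB (Permₚ.↭-shift AB (map inj₁ (lefts xs)) _))

map-↭⁻ : (A B : Web) (f : ∣ A ∣ → ∣ B ∣) (g : ∣ B ∣ → ∣ A ∣) →
          (∀ {x y} → Setoid._≈_ B x y → Setoid._≈_ A (g x) (g y)) → (∀ x → g (f x) ≡ x) →
          ∀ {xs ys} → map f xs ↭[ B ] map f ys → xs ↭[ A ] ys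
map-↭⁻ A B f g g-cong gf≡id {xs} {ys} p =
  P.subst₂ (Permutation A) (map-retraction f g gf≡id xs) (map-retraction f g gf≡id ys) (Permₚ.map⁺ B A g-cong p)

module _ {A B : Web} {R : ∣ A ∣ → ∣ B ∣ → Set}
         (R-respʳ : R Respectsʳ Setoid._≈_ B) (R-respˡ : R Respectsˡ Setoid._≈_ A) where

  ↭-Pointwiseʳ : ∀ {xs ys ys'} → Pointwise R xs ys → ys ↭[ B ] ys' →
                 ∃ λ xs' → xs ↭[ A ] xs' × Pointwise R xs' ys'
  ↭-Pointwiseʳ {xs} pw (H.refl ys≋ys') = xs , ↭-refl A , PW.transitive (λ r e → R-respʳ e r) pw ys≋ys'
  ↭-Pointwiseʳ (r ∷ pw) (H.prep e p) =
    let (xs' , q , pw') = ↭-Pointwiseʳ pw p in _ , ↭-prep A _ q , R-respʳ e r ∷ pw'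
  ↭-Pointwiseʳ (r₁ ∷ r₂ ∷ pw) (H.swap e₁ e₂ p) =
    let (xs' , q , pw') = ↭-Pointwiseʳ pw p in _ , ↭-swap A _ _ q , R-respʳ e₂ r₂ ∷ R-respʳ e₁ r₁ ∷ pw'
  ↭-Pointwiseʳ pw (H.trans p p') =
    let (xs₁ , q , pw₁) = ↭-Pointwiseʳ pw p ; (xs₂ , q' , pw₂) = ↭-Pointwiseʳ pw₁ p'
    in xs₂ , ↭-trans A q q' , pw₂

  ↭-Pointwiseˡ : ∀ {xs' xs ys} → xs' ↭[ A ] xs → Pointwise R xs ys →
                 ∃ λ ys' → Pointwise R xs' ys' × ys' ↭[ B ] ys
  ↭-Pointwiseˡ {ys = ys} (H.refl xs'≋xs) pw = ys , PW.transitive (λ e r → R-respˡ (Setoid.sym A e) r) xs'≋xs pw , ↭-refl B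
  ↭-Pointwiseˡ (H.prep e p) (r ∷ pw) =
    let (ys' , pw' , q) = ↭-Pointwiseˡ p pw in _ , R-respˡ (Setoid.sym A e) r ∷ pw' , ↭-prep B _ q
  ↭-Pointwiseˡ (H.swap e₁ e₂ p) (r₁ ∷ r₂ ∷ pw) =
    let (ys' , pw' , q) = ↭-Pointwiseˡ p pw
    in _ , R-respˡ (Setoid.sym A e₁) r₂ ∷ R-respˡ (Setoid.sym A e₂) r₁ ∷ pw' , ↭-swap B _ _ q
  ↭-Pointwiseˡ (H.trans p p') pw =
    let (ys₁ , pw₁ , q) = ↭-Pointwiseˡ p' pw ; (ys₂ , pw₂ , q') = ↭-Pointwiseˡ p pw₁
    in ys₂ , pw₂ , ↭-trans B q' q

-- Elements of the relations of the category

⟦_⟧ : {X Y : PreNUTS} → Rel X Y → ∣ web X ∣ → ∣ web Y ∣ → Set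
⟦ t ⟧ a b = t ∋ (a , b)

module _ {X Y : PreNUTS} (t : Rel X Y) where

  ∋-respʳ : ⟦ t ⟧ Respectsʳ Setoid._≈_ (web Y)
  ∋-respʳ b≈b' = resp (rsub t) (Setoid.refl (web X) , b≈b')

  ∋-respˡ : ⟦ t ⟧ Respectsˡ Setoid._≈_ (web X)
  ∋-respˡ a≈a' = resp (rsub t) (a≈a' , Setoid.refl (web Y))

  ⟦⟧-↭ʳ : ∀ {xs ys ys'} → Pointwise ⟦ t ⟧ xs ys → ys ↭[ web Y ] ys' →
          ∃ λ xs' → xs ↭[ web X ] xs' × Pointwise ⟦ t ⟧ xs' ys'
  ⟦⟧-↭ʳ = ↭-Pointwiseʳ {web X} {web Y} {⟦ t ⟧} ∋-respʳ ∋-respˡ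

  ⟦⟧-↭ˡ : ∀ {xs' xs ys} → xs' ↭[ web X ] xs → Pointwise ⟦ t ⟧ xs ys →
          ∃ λ ys' → Pointwise ⟦ t ⟧ xs' ys' × ys' ↭[ web Y ] ys
  ⟦⟧-↭ˡ = ↭-Pointwiseˡ {web X} {web Y} {⟦ t ⟧} ∋-respʳ ∋-respˡ

  !R⁻ : ∀ {l₁ l₂} → !R t ∋ (l₁ , l₂) → ∃ λ m → Pointwise ⟦ t ⟧ l₁ m × m ↭[ web Y ] l₂
  !R⁻ ((l₁' , l₂') , (l₁↭l₁' , l₂↭l₂') , pw) =
    let (m , pw' , m↭l₂') = ⟦⟧-↭ˡ l₁↭l₁' pw
    in m , pw' , ↭-trans (web Y) m↭l₂' (↭-sym (web Y) l₂↭l₂')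

  !R⁺ : ∀ {l₁ l₁' m l₂} → l₁ ↭[ web X ] l₁' → Pointwise ⟦ t ⟧ l₁' m → m ↭[ web Y ] l₂ → !R t ∋ (l₁ , l₂)
  !R⁺ {l₁' = l₁'} {m} l₁↭l₁' pw m↭l₂ = (l₁' , m) , (l₁↭l₁' , ↭-sym (web Y) m↭l₂) , pw

  !R-++ : ∀ {k₁ k₂ l₁ l₂} → !R t ∋ (k₁ , l₁) → !R t ∋ (k₂ , l₂) → !R t ∋ (k₁ ++ k₂ , l₁ ++ l₂)
  !R-++ r₁ r₂ = let (m₁ , pw₁ , m₁↭) = !R⁻ r₁ ; (m₂ , pw₂ , m₂↭) = !R⁻ r₂
                in !R⁺ (↭-refl (web X)) (PW.++⁺ pw₁ pw₂) (↭-++ (web Y) m₁↭ m₂↭)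

  !R-concat : ∀ {Ks Ls} → Pointwise ⟦ !R t ⟧ Ks Ls → !R t ∋ (concat Ks , concat Ls)
  !R-concat [] = !R⁺ (↭-refl (web X)) [] (↭-refl (web Y))
  !R-concat (r ∷ rs) = !R-++ r (!R-concat rs)

module _ {X Y Z : PreNUTS} (s : Rel X Y) (t : Rel Y Z) where

  ⨾⁻ : ∀ {a c} → (s ⨾ t) ∋ (a , c) → ∃ λ b → s ∋ (a , b) × t ∋ (b , c)
  ⨾⁻ (_ , (a≈ , c≈) , b , sab , tbc) =
    b , ∋-respˡ s (Setoid.sym (web X) a≈) sab , ∋-respʳ t (Setoid.sym (web Z) c≈) tbc

  ⨾⁺ : ∀ {a} b {c} → s ∋ (a , b) → t ∋ (b , c) → (s ⨾ t) ∋ (a , c)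
  ⨾⁺ b sab tbc = _ , (Setoid.refl (web X) , Setoid.refl (web Z)) , b , sab , tbc

module _ (X : PreNUTS) where

  idR⁻ : ∀ {a b} → idR X ∋ (a , b) → Setoid._≈_ (web X) a b
  idR⁻ (_ , (a≈ , b≈) , refl) = Setoid.trans (web X) a≈ (Setoid.sym (web X) b≈)

  idR⁺ : ∀ {a b} → Setoid._≈_ (web X) a b → idR X ∋ (a , b)
  idR⁺ a≈b = _ , (Setoid.refl (web X) , Setoid.sym (web X) a≈b) , refl

  der⁻ : ∀ {l a} → der X ∋ (l , a) → l ↭[ web X ] (a ∷ [])
  der⁻ (_ , (l↭ , a≈) , refl) = ↭-trans (web X) l↭ (H.prep (Setoid.sym (web X) a≈) (↭-refl (web X)))

  der⁺ : ∀ {l a} → l ↭[ web X ] (a ∷ []) → der X ∋ (l , a)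
  der⁺ l↭ = _ , (l↭ , Setoid.refl (web X)) , refl

module _ {X X' Y Y' : PreNUTS} (s : Rel X X') (t : Rel Y Y') where

  ⊗R⁻ : ∀ {a b a' b'} → _⊗R_ {X} {X'} {Y} {Y'} s t ∋ ((a , b) , (a' , b')) → s ∋ (a , a') × t ∋ (b , b')
  ⊗R⁻ (_ , ((a≈ , b≈) , (a'≈ , b'≈)) , sa , tb) =
    ∋-respˡ s (Setoid.sym (web X) a≈) (∋-respʳ s (Setoid.sym (web X') a'≈) sa) ,
    ∋-respˡ t (Setoid.sym (web Y) b≈) (∋-respʳ t (Setoid.sym (web Y') b'≈) tb)

  ⊗R⁺ : ∀ {a b a' b'} → s ∋ (a , a') → t ∋ (b , b') → _⊗R_ {X} {X'} {Y} {Y'} s t ∋ ((a , b) , (a' , b'))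
  ⊗R⁺ sa tb = _ , ((Setoid.refl (web X) , Setoid.refl (web Y)) , (Setoid.refl (web X') , Setoid.refl (web Y'))) , sa , tb

module _ (X : PreNUTS) where

  dig⁻ : ∀ {l L} → dig X ∋ (l , L) → l ↭[ web X ] concat L
  dig⁻ (_ , (l↭ , L↭) , refl) = ↭-trans (web X) l↭ (↭-concat (web X) (↭-sym (MfinW (web X)) L↭))

  dig⁺ : ∀ {l L} → l ↭[ web X ] concat L → dig X ∋ (l , L)
  dig⁺ l↭ = _ , (l↭ , ↭-refl (MfinW (web X))) , refl

module _ (X Y : PreNUTS) where
  private
    XY : Web
    XY = web X ⊎w web Y

  m²⁻ : ∀ {l₁ l₂ l} → m² X Y ∋ ((l₁ , l₂) , l) → l ↭[ XY ] (l₁ ⊕ l₂)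
  m²⁻ (_ , ((l₁↭ , l₂↭) , l↭) , refl) =
    ↭-trans XY l↭ (⊕-↭ (web X) (web Y) (↭-sym (web X) l₁↭) (↭-sym (web Y) l₂↭))

  m²⁺ : ∀ {l₁ l₂ l} → l ↭[ XY ] (l₁ ⊕ l₂) → m² X Y ∋ ((l₁ , l₂) , l)
  m²⁺ l↭ = _ , ((↭-refl (web X) , ↭-refl (web Y)) , l↭) , refl

module _ {X Y : PreNUTS} where
  private
    XY : Web
    XY = web X ⊎w web Y

  π₁⁻ : ∀ {x a} → π₁ {X} {Y} ∋ (x , a) → Setoid._≈_ XY x (inj₁ a)
  π₁⁻ ((inj₁ _ , _) , (x≈ , a≈) , refl) = Setoid.trans XY x≈ (⊎ₚ.inj₁ (Setoid.sym (web X) a≈))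

  π₂⁻ : ∀ {x b} → π₂ {X} {Y} ∋ (x , b) → Setoid._≈_ XY x (inj₂ b)
  π₂⁻ ((inj₂ _ , _) , (x≈ , b≈) , refl) = Setoid.trans XY x≈ (⊎ₚ.inj₂ (Setoid.sym (web Y) b≈))

  π₁∋ : ∀ a → π₁ {X} {Y} ∋ (inj₁ a , a)
  π₁∋ _ = _ , (Setoid.refl XY , Setoid.refl (web X)) , refl

  π₂∋ : ∀ b → π₂ {X} {Y} ∋ (inj₂ b , b)
  π₂∋ _ = _ , (Setoid.refl XY , Setoid.refl (web Y)) , refl

module _ {Z X Y : PreNUTS} (f : Rel Z X) (g : Rel Z Y) where

  ⟨,⟩⁻₁ : ∀ {c a} → ⟨_,_⟩ {Z} {X} {Y} f g ∋ (c , inj₁ a) → f ∋ (c , a)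
  ⟨,⟩⁻₁ ((_ , inj₁ _) , (c≈ , ⊎ₚ.inj₁ a≈) , r) =
    ∋-respˡ f (Setoid.sym (web Z) c≈) (∋-respʳ f (Setoid.sym (web X) a≈) r)

  ⟨,⟩⁻₂ : ∀ {c b} → ⟨_,_⟩ {Z} {X} {Y} f g ∋ (c , inj₂ b) → g ∋ (c , b)
  ⟨,⟩⁻₂ ((_ , inj₂ _) , (c≈ , ⊎ₚ.inj₂ b≈) , r) =
    ∋-respˡ g (Setoid.sym (web Z) c≈) (∋-respʳ g (Setoid.sym (web Y) b≈) r)

  ⟨,⟩⁺₁ : ∀ {c a} → f ∋ (c , a) → ⟨_,_⟩ {Z} {X} {Y} f g ∋ (c , inj₁ a)
  ⟨,⟩⁺₁ r = _ , (Setoid.refl (web Z) , ⊎ₚ.inj₁ (Setoid.refl (web X))) , r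

  ⟨,⟩⁺₂ : ∀ {c b} → g ∋ (c , b) → ⟨_,_⟩ {Z} {X} {Y} f g ∋ (c , inj₂ b)
  ⟨,⟩⁺₂ r = _ , (Setoid.refl (web Z) , ⊎ₚ.inj₂ (Setoid.refl (web Y))) , r

module _ {X X' Y Y' : PreNUTS} (s : Rel X X') (t : Rel Y Y') where
  private
    s&t : Rel (X & Y) (X' & Y')
    s&t = _&R_ {X} {X'} {Y} {Y'} s t

  &R⁻ : ∀ {x y} → s&t ∋ (x , y) → ⊎ₚ.Pointwise ⟦ s ⟧ ⟦ t ⟧ x y
  &R⁻ {y = inj₁ _} r with a , πa , sa ← ⨾⁻ (π₁ {X} {Y}) s (⟨,⟩⁻₁ (π₁ {X} {Y} ⨾ s) (π₂ {X} {Y} ⨾ t) r)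
    with ⊎ₚ.inj₁ x≈ ← π₁⁻ {X} {Y} πa = ⊎ₚ.inj₁ (∋-respˡ s (Setoid.sym (web X) x≈) sa)
  &R⁻ {y = inj₂ _} r with b , πb , tb ← ⨾⁻ (π₂ {X} {Y}) t (⟨,⟩⁻₂ (π₁ {X} {Y} ⨾ s) (π₂ {X} {Y} ⨾ t) r)
    with ⊎ₚ.inj₂ x≈ ← π₂⁻ {X} {Y} πb = ⊎ₚ.inj₂ (∋-respˡ t (Setoid.sym (web Y) x≈) tb)

  &R⁺ : ∀ {x y} → ⊎ₚ.Pointwise ⟦ s ⟧ ⟦ t ⟧ x y → s&t ∋ (x , y)
  &R⁺ (⊎ₚ.inj₁ r) = ⟨,⟩⁺₁ (π₁ {X} {Y} ⨾ s) (π₂ {X} {Y} ⨾ t) (⨾⁺ (π₁ {X} {Y}) s _ (π₁∋ {X} {Y} _) r)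
  &R⁺ (⊎ₚ.inj₂ r) = ⟨,⟩⁺₂ (π₁ {X} {Y} ⨾ s) (π₂ {X} {Y} ⨾ t) (⨾⁺ (π₂ {X} {Y}) t _ (π₂∋ {X} {Y} _) r)

module _ (X : PreNUTS) where
  open Setoid (web X) using (_≈_) renaming (refl to ≈-refl; sym to ≈-sym; trans to ≈-trans)

  λ⊗⁻ : ∀ {u a a'} → λ⊗ X ∋ ((u , a) , a') → a ≈ a'
  λ⊗⁻ (_ , ((_ , a≈) , a'≈) , refl) = ≈-trans a≈ (≈-sym a'≈)

  λ⊗⁺ : ∀ {u a a'} → a ≈ a' → λ⊗ X ∋ ((u , a) , a')
  λ⊗⁺ a≈a' = _ , ((refl , ≈-refl) , ≈-sym a≈a') , refl

  ρ⊗⁻ : ∀ {u a a'} → ρ⊗ X ∋ ((a , u) , a') → a ≈ a'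
  ρ⊗⁻ (_ , ((a≈ , _) , a'≈) , refl) = ≈-trans a≈ (≈-sym a'≈)

  ρ⊗⁺ : ∀ {u a a'} → a ≈ a' → ρ⊗ X ∋ ((a , u) , a')
  ρ⊗⁺ a≈a' = _ , ((≈-refl , refl) , ≈-sym a≈a') , refl

module _ (X Y : PreNUTS) where
  open Setoid (web X) using () renaming (_≈_ to _≈ˣ_; refl to ≈ˣ-refl; sym to ≈ˣ-sym; trans to ≈ˣ-trans)
  open Setoid (web Y) using () renaming (_≈_ to _≈ʸ_; refl to ≈ʸ-refl; sym to ≈ʸ-sym; trans to ≈ʸ-trans)

  σ⊗⁻ : ∀ {a a' b b'} → σ⊗ X Y ∋ ((a , b) , (b' , a')) → a ≈ˣ a' × b ≈ʸ b'
  σ⊗⁻ (_ , ((a≈ , b≈) , (b'≈ , a'≈)) , refl , refl) = ≈ˣ-trans a≈ (≈ˣ-sym a'≈) , ≈ʸ-trans b≈ (≈ʸ-sym b'≈)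

  σ⊗⁺ : ∀ {a a' b b'} → a ≈ˣ a' → b ≈ʸ b' → σ⊗ X Y ∋ ((a , b) , (b' , a'))
  σ⊗⁺ a≈a' b≈b' = _ , ((≈ˣ-refl , ≈ʸ-refl) , (≈ʸ-sym b≈b' , ≈ˣ-sym a≈a')) , refl , refl

module _ (X Y Z : PreNUTS) where
  open Setoid (web X) using () renaming (_≈_ to _≈ˣ_; refl to ≈ˣ-refl; sym to ≈ˣ-sym; trans to ≈ˣ-trans)
  open Setoid (web Y) using () renaming (_≈_ to _≈ʸ_; refl to ≈ʸ-refl; sym to ≈ʸ-sym; trans to ≈ʸ-trans)
  open Setoid (web Z) using () renaming (_≈_ to _≈ᶻ_; refl to ≈ᶻ-refl; sym to ≈ᶻ-sym; trans to ≈ᶻ-trans)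

  α⊗⁻ : ∀ {a a' b b' c c'} → α⊗ X Y Z ∋ (((a , b) , c) , (a' , (b' , c'))) → a ≈ˣ a' × b ≈ʸ b' × c ≈ᶻ c'
  α⊗⁻ (_ , (((a≈ , b≈) , c≈) , (a'≈ , (b'≈ , c'≈))) , refl , refl , refl) =
    ≈ˣ-trans a≈ (≈ˣ-sym a'≈) , ≈ʸ-trans b≈ (≈ʸ-sym b'≈) , ≈ᶻ-trans c≈ (≈ᶻ-sym c'≈)

  α⊗⁺ : ∀ {a b c} → α⊗ X Y Z ∋ (((a , b) , c) , (a , (b , c)))
  α⊗⁺ = _ , (((≈ˣ-refl , ≈ʸ-refl) , ≈ᶻ-refl) , (≈ˣ-refl , (≈ʸ-refl , ≈ᶻ-refl))) , refl , refl , refl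

record IsConverseOf {X Y : PreNUTS} (t : Rel X Y) (h : ∣ web Y ∣ → ∣ web X ∣) : Set where
  field
    h-cong : ∀ {y y'} → Setoid._≈_ (web Y) y y' → Setoid._≈_ (web X) (h y) (h y')
    ∋⇒≈h   : ∀ {x y} → t ∋ (x , y) → Setoid._≈_ (web X) x (h y)
    h∋     : ∀ y → t ∋ (h y , y)

module _ {X Y : PreNUTS} {t : Rel X Y} {h : ∣ web Y ∣ → ∣ web X ∣} (conv : IsConverseOf t h) where
  open IsConverseOf conv

  map-↭ : ∀ {L L'} → L ↭[ web Y ] L' → map h L ↭[ web X ] map h L'
  map-↭ = Permₚ.map⁺ (web Y) (web X) h-cong

  !R-converse⁻ : ∀ {K L} → !R t ∋ (K , L) → K ↭[ web X ] map h L
  !R-converse⁻ r =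
    let (m , pw , m↭L) = !R⁻ t r in ↭-trans (web X) (H.refl (Pointwise-mapʳ h (PW.map ∋⇒≈h pw))) (map-↭ m↭L)

  !R-converse⁺ : ∀ {K L} → K ↭[ web X ] map h L → !R t ∋ (K , L)
  !R-converse⁺ K↭ = !R⁺ t K↭ (Pointwise-mapˡ h (PW.refl (λ {y} → h∋ y))) (↭-refl (web Y))

module _ {X Y : PreNUTS} where

  π₁-converse : IsConverseOf (π₁ {X} {Y}) inj₁
  π₁-converse = record { h-cong = ⊎ₚ.inj₁ ; ∋⇒≈h = π₁⁻ ; h∋ = π₁∋ }

  π₂-converse : IsConverseOf (π₂ {X} {Y}) inj₂
  π₂-converse = record { h-cong = ⊎ₚ.inj₂ ; ∋⇒≈h = π₂⁻ ; h∋ = π₂∋ }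

swap-cong : (A B : Web) {x y : ∣ A ⊎w B ∣} → Setoid._≈_ (A ⊎w B) x y → Setoid._≈_ (B ⊎w A) (swap x) (swap y)
swap-cong A B (⊎ₚ.inj₁ e) = ⊎ₚ.inj₂ e
swap-cong A B (⊎ₚ.inj₂ e) = ⊎ₚ.inj₁ e

σ&-converse : (X Y : PreNUTS) → IsConverseOf (σ& X Y) swap
σ&-converse X Y = record
  { h-cong = swap-cong (web Y) (web X)
  ; ∋⇒≈h   = λ { {y = inj₁ _} r → π₂⁻ {X} {Y} (⟨,⟩⁻₁ (π₂ {X} {Y}) (π₁ {X} {Y}) r)
               ; {y = inj₂ _} r → π₁⁻ {X} {Y} (⟨,⟩⁻₂ (π₂ {X} {Y}) (π₁ {X} {Y}) r) }
  ; h∋     = λ { (inj₁ _) → ⟨,⟩⁺₁ (π₂ {X} {Y}) (π₁ {X} {Y}) (π₂∋ {X} {Y} _)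
               ; (inj₂ _) → ⟨,⟩⁺₂ (π₂ {X} {Y}) (π₁ {X} {Y}) (π₁∋ {X} {Y} _) } }

assocˡ-cong : (A B C : Web) {x y : ∣ A ⊎w (B ⊎w C) ∣} → Setoid._≈_ (A ⊎w (B ⊎w C)) x y →
              Setoid._≈_ ((A ⊎w B) ⊎w C) (assocˡ x) (assocˡ y)
assocˡ-cong A B C (⊎ₚ.inj₁ e) = ⊎ₚ.inj₁ (⊎ₚ.inj₁ e)
assocˡ-cong A B C (⊎ₚ.inj₂ (⊎ₚ.inj₁ e)) = ⊎ₚ.inj₁ (⊎ₚ.inj₂ e)
assocˡ-cong A B C (⊎ₚ.inj₂ (⊎ₚ.inj₂ e)) = ⊎ₚ.inj₂ e

assocʳ-cong : (A B C : Web) {x y : ∣ (A ⊎w B) ⊎w C ∣} → Setoid._≈_ ((A ⊎w B) ⊎w C) x y →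
              Setoid._≈_ (A ⊎w (B ⊎w C)) (assocʳ x) (assocʳ y)
assocʳ-cong A B C (⊎ₚ.inj₁ (⊎ₚ.inj₁ e)) = ⊎ₚ.inj₁ e
assocʳ-cong A B C (⊎ₚ.inj₁ (⊎ₚ.inj₂ e)) = ⊎ₚ.inj₂ (⊎ₚ.inj₁ e)
assocʳ-cong A B C (⊎ₚ.inj₂ e) = ⊎ₚ.inj₂ (⊎ₚ.inj₂ e)

assocʳ-assocˡ : {A B C : Set} (x : A ⊎ (B ⊎ C)) → assocʳ (assocˡ x) ≡ x
assocʳ-assocˡ (inj₁ _) = refl
assocʳ-assocˡ (inj₂ (inj₁ _)) = refl
assocʳ-assocˡ (inj₂ (inj₂ _)) = refl

α&-converse : (X Y Z : PreNUTS) → IsConverseOf (α& X Y Z) assocˡ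
α&-converse X Y Z = record { h-cong = assocˡ-cong (web X) (web Y) (web Z) ; ∋⇒≈h = ∋⇒≈h ; h∋ = h∋ }
  where
  W : Web
  W = (web X ⊎w web Y) ⊎w web Z
  π₁₁ : Rel ((X & Y) & Z) X
  π₁₁ = π₁ {X & Y} {Z} ⨾ π₁ {X} {Y}
  π₁₂ : Rel ((X & Y) & Z) Y
  π₁₂ = π₁ {X & Y} {Z} ⨾ π₂ {X} {Y}
  ⟨π₁₂,π₂⟩ : Rel ((X & Y) & Z) (Y & Z)
  ⟨π₁₂,π₂⟩ = ⟨_,_⟩ {(X & Y) & Z} {Y} {Z} π₁₂ (π₂ {X & Y} {Z})

  ∋⇒≈h : ∀ {x y} → α& X Y Z ∋ (x , y) → Setoid._≈_ W x (assocˡ y)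
  ∋⇒≈h {y = inj₁ _} r with _ , p , q ← ⨾⁻ (π₁ {X & Y} {Z}) (π₁ {X} {Y}) (⟨,⟩⁻₁ π₁₁ ⟨π₁₂,π₂⟩ r) =
    Setoid.trans W (π₁⁻ {X & Y} {Z} p) (⊎ₚ.inj₁ (π₁⁻ {X} {Y} q))
  ∋⇒≈h {y = inj₂ (inj₁ _)} r
    with _ , p , q ← ⨾⁻ (π₁ {X & Y} {Z}) (π₂ {X} {Y}) (⟨,⟩⁻₁ π₁₂ (π₂ {X & Y} {Z}) (⟨,⟩⁻₂ π₁₁ ⟨π₁₂,π₂⟩ r)) =
    Setoid.trans W (π₁⁻ {X & Y} {Z} p) (⊎ₚ.inj₁ (π₂⁻ {X} {Y} q))
  ∋⇒≈h {y = inj₂ (inj₂ _)} r = π₂⁻ {X & Y} {Z} (⟨,⟩⁻₂ π₁₂ (π₂ {X & Y} {Z}) (⟨,⟩⁻₂ π₁₁ ⟨π₁₂,π₂⟩ r))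

  h∋ : ∀ y → α& X Y Z ∋ (assocˡ y , y)
  h∋ (inj₁ _) = ⟨,⟩⁺₁ π₁₁ ⟨π₁₂,π₂⟩
    (⨾⁺ (π₁ {X & Y} {Z}) (π₁ {X} {Y}) _ (π₁∋ {X & Y} {Z} _) (π₁∋ {X} {Y} _))
  h∋ (inj₂ (inj₁ _)) = ⟨,⟩⁺₂ π₁₁ ⟨π₁₂,π₂⟩ (⟨,⟩⁺₁ π₁₂ (π₂ {X & Y} {Z})
    (⨾⁺ (π₁ {X & Y} {Z}) (π₂ {X} {Y}) _ (π₁∋ {X & Y} {Z} _) (π₂∋ {X} {Y} _)))
  h∋ (inj₂ (inj₂ _)) = ⟨,⟩⁺₂ π₁₁ ⟨π₁₂,π₂⟩ (⟨,⟩⁺₂ π₁₂ (π₂ {X & Y} {Z}) (π₂∋ {X & Y} {Z} _))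

-- The comonad

!R-id : (X : PreNUTS) → !R (idR X) ≗ idR (! X)
!R-id X (l₁ , l₂) = to , from
  where
  to : !R (idR X) ∋ (l₁ , l₂) → idR (! X) ∋ (l₁ , l₂)
  to r = let (m , pw , m↭l₂) = !R⁻ (idR X) r
         in idR⁺ (! X) (↭-trans (web X) (H.refl (PW.map (idR⁻ X) pw)) m↭l₂)
  from : idR (! X) ∋ (l₁ , l₂) → !R (idR X) ∋ (l₁ , l₂)
  from r = !R⁺ (idR X) (↭-refl (web X)) (PW.refl (idR⁺ X (Setoid.refl (web X)))) (idR⁻ (! X) r)

!R-⨾ : {X Y Z : PreNUTS} (s : Rel X Y) (t : Rel Y Z) → !R (s ⨾ t) ≗ (!R s ⨾ !R t)
!R-⨾ {X} {Y} {Z} s t (l₁ , l₃) = to , from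
  where
  to : !R (s ⨾ t) ∋ (l₁ , l₃) → (!R s ⨾ !R t) ∋ (l₁ , l₃)
  to r = let (m , pw , m↭l₃) = !R⁻ (s ⨾ t) r ; (l₂ , pwˢ , pwᵗ) = Pointwise-∃⁻ (PW.map (⨾⁻ s t) pw)
         in ⨾⁺ (!R s) (!R t) l₂ (!R⁺ s (↭-refl (web X)) pwˢ (↭-refl (web Y))) (!R⁺ t (↭-refl (web Y)) pwᵗ m↭l₃)
  from : (!R s ⨾ !R t) ∋ (l₁ , l₃) → !R (s ⨾ t) ∋ (l₁ , l₃)
  from r =
    let (l₂ , r₁ , r₂) = ⨾⁻ (!R s) (!R t) r
        (m₁ , pw₁ , m₁↭l₂) = !R⁻ s r₁ ; (m₂ , pw₂ , m₂↭l₃) = !R⁻ t r₂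
        (m₂' , pw₂' , m₂'↭m₂) = ⟦⟧-↭ˡ t m₁↭l₂ pw₂
    in !R⁺ (s ⨾ t) (↭-refl (web X)) (PW.transitive (⨾⁺ s t _) pw₁ pw₂') (↭-trans (web Z) m₂'↭m₂ m₂↭l₃)

All-·⁻ : {A B : Web} (c : Sub (A ×w B)) (u : Sub A) {l : List ∣ B ∣} → All (mem (c · u)) l →
         ∃ λ l' → Pointwise (λ a b → mem c (a , b)) l' l × All (mem u) l'
All-·⁻ c u [] = [] , [] , []
All-·⁻ c u ((a , ua , cab) ∷ as) = let (l' , pw , us) = All-·⁻ c u as in a ∷ l' , cab ∷ pw , ua ∷ us

!R-Hom : (X Y : NUTS) (t : Rel (proj₁ X) (proj₁ Y)) →
         Hom (proj₁ X) (proj₁ Y) t → Hom (! (proj₁ X)) (! (proj₁ Y)) (!R t)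
!R-Hom 𝕏@(X , _) 𝕐@(Y , _) t h = Hom⁺ (! X) (! Y) (!R t) (!-generators X) (λ _ T → T) meets
  where
  meets : ∀ w v → !-generators X w → (tot (! Y) ᗮ) v → (w ⊠ v) ≬ rsub (!R t)
  meets w v (u , Tu , w≐) Tᗮv
    with l , (l' , l↭l' , ts) , vl ← ᗮᗮᗮ⇒ᗮ (!-generators Y) v Tᗮv (Mfin (rsub t · u))
                                        (rsub t · u , Hom-image 𝕏 𝕐 t h u Tu , ≐-refl (Mfin {web Y} (rsub t · u))) =
    let (k , pw , us) = All-·⁻ (rsub t) u ts
    in (k , l) , (proj₂ (w≐ k) (k , ↭-refl (web X) , us) , vl) ,
       !R⁺ t (↭-refl (web X)) pw (↭-sym (web Y) l↭l')

der-Hom : (X : PreNUTS) → Hom (! X) X (der X)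
der-Hom X = Hom⁺ (! X) X (der X) (!-generators X) (λ _ T → T) meets
  where
  meets : ∀ w v → !-generators X w → (tot X ᗮ) v → (w ⊠ v) ≬ rsub (der X)
  meets w v (u , Tu , w≐) Tᗮv =
    let (a , ua , va) = Tᗮv u Tu
    in (a ∷ [] , a) , (proj₂ (w≐ (a ∷ [])) (a ∷ [] , ↭-refl (web X) , ua ∷ []) , va) , der⁺ X (↭-refl (web X))

Mfin-concat : {A : Web} (u : Sub A) {L : List (List ∣ A ∣)} → All (mem (Mfin u)) L → mem (Mfin u) (concat L)
Mfin-concat {A} u [] = [] , ↭-refl A , []
Mfin-concat {A} u ((l' , l↭ , us) ∷ Us) =
  let (k , L↭ , us') = Mfin-concat u Us in l' ++ k , ↭-++ A l↭ L↭ , Allₚ.++⁺ us us'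

dig-Hom : (X : PreNUTS) → Hom (! X) (! (! X)) (dig X)
dig-Hom X = Hom⁺ (! X) (! (! X)) (dig X) (!-generators X) (λ _ T → T) meets
  where
  A : Web
  A = web X
  meets : ∀ w v → !-generators X w → (tot (! (! X)) ᗮ) v → (w ⊠ v) ≬ rsub (dig X)
  meets w v (u , Tu , w≐) Tᗮv
    with L , (L' , L↭L' , Us) , vL ← ᗮᗮᗮ⇒ᗮ (!-generators (! X)) v Tᗮv (Mfin (Mfin u))
           (Mfin u , ⊆-ᗮᗮ (!-generators X) (Mfin u) (u , Tu , ≐-refl (Mfin u)) , ≐-refl (Mfin (Mfin u))) =
    (concat L , L) ,
    (proj₂ (w≐ (concat L)) (Mfin-concat u (Permₚ.All-resp-↭ (MfinW A) (resp (Mfin u)) (↭-sym (MfinW A) L↭L') Us)) , vL) ,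
    dig⁺ X (↭-refl A)

der-natural : {X Y : PreNUTS} (t : Rel X Y) → (!R t ⨾ der Y) ≗ (der X ⨾ t)
der-natural {X} {Y} t (l , b) = to , from
  where
  to : (!R t ⨾ der Y) ∋ (l , b) → (der X ⨾ t) ∋ (l , b)
  to r with m , r₁ , r₂ ← ⨾⁻ (!R t) (der Y) r
       with n , pw , n↭m ← !R⁻ t r₁
       with b' , refl , b'≈b ← ↭-[-]⁻ (web Y) (↭-trans (web Y) n↭m (der⁻ Y r₂))
       with tab ∷ [] ← pw = ⨾⁺ (der X) t _ (der⁺ X (↭-refl (web X))) (∋-respʳ t b'≈b tab)
  from : (der X ⨾ t) ∋ (l , b) → (!R t ⨾ der Y) ∋ (l , b)
  from r = let (a , r₁ , tab) = ⨾⁻ (der X) t r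
           in ⨾⁺ (!R t) (der Y) _ (!R⁺ t (der⁻ X r₁) (tab ∷ []) (↭-refl (web Y))) (der⁺ Y (↭-refl (web Y)))

dig-natural : {X Y : PreNUTS} (t : Rel X Y) → (!R t ⨾ dig Y) ≗ (dig X ⨾ !R (!R t))
dig-natural {X} {Y} t (l , L) = to , from
  where
  to : (!R t ⨾ dig Y) ∋ (l , L) → (dig X ⨾ !R (!R t)) ∋ (l , L)
  to r with m , r₁ , r₂ ← ⨾⁻ (!R t) (dig Y) r
       with n , pw , n↭m ← !R⁻ t r₁
       with l' , l↭l' , pw' ← ⟦⟧-↭ʳ t pw (↭-trans (web Y) n↭m (dig⁻ Y r₂))
       with M , refl , pws ← Pointwise-concat⁻ʳ L pw' =
    ⨾⁺ (dig X) (!R (!R t)) M (dig⁺ X l↭l')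
       (!R⁺ (!R t) (↭-refl (MfinW (web X))) (PW.map (λ p → !R⁺ t (↭-refl (web X)) p (↭-refl (web Y))) pws)
            (↭-refl (MfinW (web Y))))
  from : (dig X ⨾ !R (!R t)) ∋ (l , L) → (!R t ⨾ dig Y) ∋ (l , L)
  from r = let (M , r₁ , r₂) = ⨾⁻ (dig X) (!R (!R t)) r ; (N , pw , N↭L) = !R⁻ (!R t) r₂
               (k , pw' , k↭) = !R⁻ t (!R-concat t pw)
           in ⨾⁺ (!R t) (dig Y) _ (!R⁺ t (dig⁻ X r₁) pw' (↭-refl (web Y)))
                 (dig⁺ Y (↭-trans (web Y) k↭ (↭-concat (web Y) N↭L)))

dig⨾der : (X : PreNUTS) → (dig X ⨾ der (! X)) ≗ idR (! X)
dig⨾der X (l , l') = to , from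
  where
  A : Web
  A = web X
  to : (dig X ⨾ der (! X)) ∋ (l , l') → idR (! X) ∋ (l , l')
  to r with L , r₁ , r₂ ← ⨾⁻ (dig X) (der (! X)) r
       with l'' , refl , l''↭l' ← ↭-[-]⁻ (MfinW A) (der⁻ (! X) r₂) =
    idR⁺ (! X) (↭-trans A (dig⁻ X r₁) (↭-trans A (Permₚ.++-identityʳ A l'') l''↭l'))
  from : idR (! X) ∋ (l , l') → (dig X ⨾ der (! X)) ∋ (l , l')
  from r = ⨾⁺ (dig X) (der (! X)) (l' ∷ [])
             (dig⁺ X (↭-trans A (idR⁻ (! X) r) (↭-sym A (Permₚ.++-identityʳ A l'))))
             (der⁺ (! X) (↭-refl (MfinW A)))

dig⨾!der : (X : PreNUTS) → (dig X ⨾ !R (der X)) ≗ idR (! X)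
dig⨾!der X (l , l') = to , from
  where
  A : Web
  A = web X
  concat-singletons : ∀ {Ls m} → Pointwise ⟦ der X ⟧ Ls m → concat Ls ↭[ A ] m
  concat-singletons {Ls} {m} pw = P.subst (Permutation A (concat Ls)) (concat-map-[_] m)
    (↭-concat-Pointwise A (Pointwise-mapʳ (_∷ []) (PW.map (der⁻ X) pw)))
  to : (dig X ⨾ !R (der X)) ∋ (l , l') → idR (! X) ∋ (l , l')
  to r = let (L , r₁ , r₂) = ⨾⁻ (dig X) (!R (der X)) r ; (m , pw , m↭l') = !R⁻ (der X) r₂
         in idR⁺ (! X) (↭-trans A (dig⁻ X r₁) (↭-trans A (concat-singletons pw) m↭l'))
  singletons : Pointwise ⟦ der X ⟧ (map (_∷ []) l) l
  singletons = Pointwise-mapˡ (_∷ []) (PW.refl (der⁺ X (↭-refl A)))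
  from : idR (! X) ∋ (l , l') → (dig X ⨾ !R (der X)) ∋ (l , l')
  from r = ⨾⁺ (dig X) (!R (der X)) _ (dig⁺ X (↭-sym A (concat-singletons singletons)))
             (!R⁺ (der X) (↭-refl (MfinW A)) singletons (idR⁻ (! X) r))

dig⨾dig : (X : PreNUTS) → (dig X ⨾ dig (! X)) ≗ (dig X ⨾ !R (dig X))
dig⨾dig X (l , 𝕃) = to , from
  where
  A : Web
  A = web X
  concat-pointwise : ∀ {Ms 𝕄} → Pointwise ⟦ dig X ⟧ Ms 𝕄 → concat Ms ↭[ A ] concat (concat 𝕄)
  concat-pointwise {Ms} {𝕄} pw = P.subst (Permutation A (concat Ms)) (concat-concat 𝕄)
    (↭-concat-Pointwise A (Pointwise-mapʳ concat (PW.map (dig⁻ X) pw)))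
  unions : Pointwise ⟦ dig X ⟧ (map concat 𝕃) 𝕃
  unions = Pointwise-mapˡ concat (PW.refl (dig⁺ X (↭-refl A)))
  to : (dig X ⨾ dig (! X)) ∋ (l , 𝕃) → (dig X ⨾ !R (dig X)) ∋ (l , 𝕃)
  to r = let (M , r₁ , r₂) = ⨾⁻ (dig X) (dig (! X)) r
         in ⨾⁺ (dig X) (!R (dig X)) _
              (dig⁺ X (↭-trans A (dig⁻ X r₁)
                (↭-trans A (↭-concat A (dig⁻ (! X) r₂)) (↭-sym A (concat-pointwise unions)))))
              (!R⁺ (dig X) (↭-refl (MfinW A)) unions (↭-refl (MfinW (MfinW A))))
  from : (dig X ⨾ !R (dig X)) ∋ (l , 𝕃) → (dig X ⨾ dig (! X)) ∋ (l , 𝕃)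
  from r = let (M , r₁ , r₂) = ⨾⁻ (dig X) (!R (dig X)) r ; (ℕ , pw , ℕ↭𝕃) = !R⁻ (dig X) r₂
           in ⨾⁺ (dig X) (dig (! X)) _
                (dig⁺ X (↭-trans A (dig⁻ X r₁) (↭-trans A (concat-pointwise pw)
                   (↭-concat A (↭-concat (MfinW A) ℕ↭𝕃)))))
                (dig⁺ (! X) (↭-refl (MfinW A)))

-- The monoidal structure (m⁰, m²)

empty-list : (l : List ⊥) → l ≡ []
empty-list [] = refl
empty-list (() ∷ _)

m⁰⁺ : ∀ {u} (l : List ⊥) → m⁰ ∋ (u , l)
m⁰⁺ l rewrite empty-list l = _ , (refl , ↭-refl emptyW) , refl

m⁰⁻¹ : Rel (! ⊤N) 𝟏
m⁰⁻¹ = rel ⟪ (λ p → proj₁ p ≡ []) ⟫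

m⁰⁻¹⁺ : ∀ {u} (l : List ⊥) → m⁰⁻¹ ∋ (l , u)
m⁰⁻¹⁺ l rewrite empty-list l = _ , (↭-refl emptyW , refl) , refl

full : (A : Web) → Sub A
full A = record { mem = λ _ → ⊤ ; resp = λ _ _ → tt }

m⁰-Hom : Hom 𝟏 (! ⊤N) m⁰
m⁰-Hom = Hom⁺ 𝟏 (! ⊤N) m⁰ (tot 𝟏) (⊆-ᗮᗮ (tot 𝟏)) meets
  where
  meets : ∀ w v → tot 𝟏 w → (tot (! ⊤N) ᗮ) v → (w ⊠ v) ≬ rsub m⁰
  meets w v (lift w*) Tᗮv =
    let (l , _ , vl) = ᗮᗮᗮ⇒ᗮ (!-generators ⊤N) v Tᗮv (Mfin (full emptyW))
                         (full emptyW , lift tt , ≐-refl (Mfin {emptyW} (full emptyW)))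
    in (tt , l) , (w* , vl) , m⁰⁺ l

m⁰-IsIso : IsIso 𝟏 (! ⊤N) m⁰
m⁰-IsIso = m⁰⁻¹ , m⁰⁻¹-Hom , m⁰⨾m⁰⁻¹ , m⁰⁻¹⨾m⁰
  where
  m⁰⨾m⁰⁻¹ : (m⁰ ⨾ m⁰⁻¹) ≗ idR 𝟏
  m⁰⨾m⁰⁻¹ _ = (λ _ → idR⁺ 𝟏 refl) , (λ _ → ⨾⁺ m⁰ m⁰⁻¹ [] (m⁰⁺ []) (m⁰⁻¹⁺ []))

  m⁰⁻¹⨾m⁰ : (m⁰⁻¹ ⨾ m⁰) ≗ idR (! ⊤N)
  m⁰⁻¹⨾m⁰ (l , l') rewrite empty-list l | empty-list l' =
    (λ _ → idR⁺ (! ⊤N) (↭-refl emptyW)) , (λ _ → ⨾⁺ m⁰⁻¹ m⁰ tt (m⁰⁻¹⁺ []) (m⁰⁺ []))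

  m⁰⁻¹-Hom : Hom (! ⊤N) 𝟏 m⁰⁻¹
  m⁰⁻¹-Hom = Hom⁺ (! ⊤N) 𝟏 m⁰⁻¹ (!-generators ⊤N) (λ _ T → T) meets
    where
    meets : ∀ w v → !-generators ⊤N w → (tot 𝟏 ᗮ) v → (w ⊠ v) ≬ rsub m⁰⁻¹
    meets w v (_ , _ , w≐) Tᗮv =
      let (_ , _ , v*) = Tᗮv (full unitW) (lift tt)
      in ([] , tt) , (proj₂ (w≐ []) ([] , ↭-refl emptyW , []) , v*) , m⁰⁻¹⁺ []

m²⁻¹ : (X Y : PreNUTS) → Rel (! (X & Y)) (! X ⊗ ! Y)
m²⁻¹ X Y = rel ⟪ (λ { (l , (l₁ , l₂)) → l ≡ l₁ ⊕ l₂ }) ⟫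

module _ (X Y : PreNUTS) where
  private
    XY : Web
    XY = web X ⊎w web Y

  m²⁻¹⁻ : ∀ {l₁ l₂ l} → m²⁻¹ X Y ∋ (l , (l₁ , l₂)) → l ↭[ XY ] (l₁ ⊕ l₂)
  m²⁻¹⁻ (_ , (l↭ , (l₁↭ , l₂↭)) , refl) =
    ↭-trans XY l↭ (⊕-↭ (web X) (web Y) (↭-sym (web X) l₁↭) (↭-sym (web Y) l₂↭))

  m²⁻¹⁺ : ∀ {l₁ l₂ l} → l ↭[ XY ] (l₁ ⊕ l₂) → m²⁻¹ X Y ∋ (l , (l₁ , l₂))
  m²⁻¹⁺ l↭ = _ , (l↭ , (↭-refl (web X) , ↭-refl (web Y))) , refl

_⊞_ : {A B : Web} → Sub A → Sub B → Sub (A ⊎w B)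
u₁ ⊞ u₂ = record
  { mem  = λ { (inj₁ a) → mem u₁ a ; (inj₂ b) → mem u₂ b }
  ; resp = λ { (⊎ₚ.inj₁ e) → resp u₁ e ; (⊎ₚ.inj₂ e) → resp u₂ e } }

All-⊞⁻ : {A B : Web} (u₁ : Sub A) (u₂ : Sub B) {l : List (∣ A ∣ ⊎ ∣ B ∣)} →
         All (mem (u₁ ⊞ u₂)) l → All (mem u₁) (lefts l) × All (mem u₂) (rights l)
All-⊞⁻ u₁ u₂ [] = [] , []
All-⊞⁻ u₁ u₂ {inj₁ _ ∷ _} (m ∷ ms) = let (ms₁ , ms₂) = All-⊞⁻ u₁ u₂ ms in m ∷ ms₁ , ms₂
All-⊞⁻ u₁ u₂ {inj₂ _ ∷ _} (m ∷ ms) = let (ms₁ , ms₂) = All-⊞⁻ u₁ u₂ ms in ms₁ , m ∷ ms₂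

All-⊕ : {A B : Web} (u : Sub (A ⊎w B)) {l₁ : List ∣ A ∣} {l₂ : List ∣ B ∣} →
        All (mem (π₁· u)) l₁ → All (mem (π₂· u)) l₂ → All (mem u) (l₁ ⊕ l₂)
All-⊕ u ms₁ ms₂ = Allₚ.++⁺ (Allₚ.map⁺ ms₁) (Allₚ.map⁺ ms₂)

m²-Hom : (X Y : NUTS) → Hom (! (proj₁ X) ⊗ ! (proj₁ Y)) (! (proj₁ X & proj₁ Y)) (m² (proj₁ X) (proj₁ Y))
m²-Hom 𝕏@(X , _) 𝕐@(Y , _) = Hom⁺ (! X ⊗ ! Y) (! (X & Y)) (m² X Y) (⊗-generators (! X) (! Y)) (λ _ T → T) meets
  where
  XY : Web
  XY = web X ⊎w web Y
  meets : ∀ w v → ⊗-generators (! X) (! Y) w → (tot (! (X & Y)) ᗮ) v → (w ⊠ v) ≬ rsub (m² X Y)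
  meets w v (w₁ , w₂ , T₁ , T₂ , w≐) Tᗮv =
    let ((l₁ , l₂) , w₁w₂ , (l , vl , m²l)) =
          ⊠-ᗮᗮ-≬ (!-generators X) (!-generators Y) (rsub (m² X Y) ⁻¹· v) on-generators {w₁} {w₂} T₁ T₂
    in ((l₁ , l₂) , l) , (proj₂ (w≐ (l₁ , l₂)) w₁w₂ , vl) , m²l
    where
    on-generators : ∀ w₁ w₂ → !-generators X w₁ → !-generators Y w₂ → (w₁ ⊠ w₂) ≬ (rsub (m² X Y) ⁻¹· v)
    on-generators w₁ w₂ (u₁ , Tu₁ , w₁≐) (u₂ , Tu₂ , w₂≐)
      with l , (l' , l↭l' , ms) , vl ← ᗮᗮᗮ⇒ᗮ (!-generators (X & Y)) v Tᗮv (Mfin (u₁ ⊞ u₂))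
             (u₁ ⊞ u₂ , (tot-resp-≐ 𝕏 (≐-refl u₁) Tu₁ , tot-resp-≐ 𝕐 (≐-refl u₂) Tu₂) ,
              ≐-refl (Mfin {XY} (u₁ ⊞ u₂))) =
      let (ms₁ , ms₂) = All-⊞⁻ u₁ u₂ ms
      in (lefts l' , rights l') ,
         (proj₂ (w₁≐ _) (lefts l' , ↭-refl (web X) , ms₁) , proj₂ (w₂≐ _) (rights l' , ↭-refl (web Y) , ms₂)) ,
         l , vl , m²⁺ X Y (↭-trans XY l↭l' (↭-lefts⊕rights (web X) (web Y) l'))

m²-IsIso : (X Y : PreNUTS) → IsIso (! X ⊗ ! Y) (! (X & Y)) (m² X Y)
m²-IsIso X Y = m²⁻¹ X Y , m²⁻¹-Hom , m²⨾m²⁻¹ , m²⁻¹⨾m²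
  where
  XY : Web
  XY = web X ⊎w web Y

  m²⁻¹-Hom : Hom (! (X & Y)) (! X ⊗ ! Y) (m²⁻¹ X Y)
  m²⁻¹-Hom = Hom⁺ (! (X & Y)) (! X ⊗ ! Y) (m²⁻¹ X Y) (!-generators (X & Y)) (λ _ T → T) meets
    where
    meets : ∀ w v → !-generators (X & Y) w → (tot (! X ⊗ ! Y) ᗮ) v → (w ⊠ v) ≬ rsub (m²⁻¹ X Y)
    meets w v (u , (T₁ , T₂) , w≐) Tᗮv
      with (l₁ , l₂) , ((l₁' , l₁↭ , ms₁) , (l₂' , l₂↭ , ms₂)) , vl
             ← ᗮᗮᗮ⇒ᗮ (⊗-generators (! X) (! Y)) v Tᗮv (Mfin (π₁· u) ⊠ Mfin (π₂· u))
                 (Mfin (π₁· u) , Mfin (π₂· u) ,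
                  ⊆-ᗮᗮ (!-generators X) (Mfin (π₁· u)) (π₁· u , T₁ , ≐-refl (Mfin (π₁· u))) ,
                  ⊆-ᗮᗮ (!-generators Y) (Mfin (π₂· u)) (π₂· u , T₂ , ≐-refl (Mfin (π₂· u))) ,
                  ≐-refl (Mfin (π₁· u) ⊠ Mfin (π₂· u))) =
      (l₁' ⊕ l₂' , (l₁ , l₂)) , (proj₂ (w≐ _) (_ , ↭-refl XY , All-⊕ u ms₁ ms₂) , vl) ,
      m²⁻¹⁺ X Y (⊕-↭ (web X) (web Y) (↭-sym (web X) l₁↭) (↭-sym (web Y) l₂↭))

  m²⨾m²⁻¹ : (m² X Y ⨾ m²⁻¹ X Y) ≗ idR (! X ⊗ ! Y)
  m²⨾m²⁻¹ ((l₁ , l₂) , (k₁ , k₂)) = to , from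
    where
    to : (m² X Y ⨾ m²⁻¹ X Y) ∋ ((l₁ , l₂) , (k₁ , k₂)) → idR (! X ⊗ ! Y) ∋ ((l₁ , l₂) , (k₁ , k₂))
    to r = let (l , r₁ , r₂) = ⨾⁻ (m² X Y) (m²⁻¹ X Y) r
           in idR⁺ (! X ⊗ ! Y) (⊕-↭⁻ (web X) (web Y) (↭-trans XY (↭-sym XY (m²⁻ X Y r₁)) (m²⁻¹⁻ X Y r₂)))
    from : idR (! X ⊗ ! Y) ∋ ((l₁ , l₂) , (k₁ , k₂)) → (m² X Y ⨾ m²⁻¹ X Y) ∋ ((l₁ , l₂) , (k₁ , k₂))
    from r = let (l₁↭k₁ , l₂↭k₂) = idR⁻ (! X ⊗ ! Y) r
             in ⨾⁺ (m² X Y) (m²⁻¹ X Y) _ (m²⁺ X Y (↭-refl XY)) (m²⁻¹⁺ X Y (⊕-↭ (web X) (web Y) l₁↭k₁ l₂↭k₂))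

  m²⁻¹⨾m² : (m²⁻¹ X Y ⨾ m² X Y) ≗ idR (! (X & Y))
  m²⁻¹⨾m² (l , l') = to , from
    where
    to : (m²⁻¹ X Y ⨾ m² X Y) ∋ (l , l') → idR (! (X & Y)) ∋ (l , l')
    to r = let (_ , r₁ , r₂) = ⨾⁻ (m²⁻¹ X Y) (m² X Y) r
           in idR⁺ (! (X & Y)) (↭-trans XY (m²⁻¹⁻ X Y r₁) (↭-sym XY (m²⁻ X Y r₂)))
    from : idR (! (X & Y)) ∋ (l , l') → (m²⁻¹ X Y ⨾ m² X Y) ∋ (l , l')
    from r = ⨾⁺ (m²⁻¹ X Y) (m² X Y) (lefts l , rights l) (m²⁻¹⁺ X Y (↭-lefts⊕rights (web X) (web Y) l))
               (m²⁺ X Y (↭-trans XY (↭-sym XY (idR⁻ (! (X & Y)) r)) (↭-lefts⊕rights (web X) (web Y) l)))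

m²-natural : {X X' Y Y' : PreNUTS} (s : Rel X X') (t : Rel Y Y') →
             (_⊗R_ { ! X} { ! X'} { ! Y} { ! Y'} (!R s) (!R t) ⨾ m² X' Y') ≗ (m² X Y ⨾ !R (_&R_ {X} {X'} {Y} {Y'} s t))
m²-natural {X} {X'} {Y} {Y'} s t ((l₁ , l₂) , l) = to , from
  where
  XY : Web
  XY = web X ⊎w web Y
  XY' : Web
  XY' = web X' ⊎w web Y'
  s&t : Rel (X & Y) (X' & Y')
  s&t = _&R_ {X} {X'} {Y} {Y'} s t
  !s⊗!t : Rel (! X ⊗ ! Y) (! X' ⊗ ! Y')
  !s⊗!t = _⊗R_ { ! X} { ! X'} { ! Y} { ! Y'} (!R s) (!R t)
  to : (!s⊗!t ⨾ m² X' Y') ∋ ((l₁ , l₂) , l) → (m² X Y ⨾ !R s&t) ∋ ((l₁ , l₂) , l)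
  to r = let (_ , r₁ , r₂) = ⨾⁻ !s⊗!t (m² X' Y') r ; (rˢ , rᵗ) = ⊗R⁻ (!R s) (!R t) r₁
             (n₁ , pw₁ , n₁↭) = !R⁻ s rˢ ; (n₂ , pw₂ , n₂↭) = !R⁻ t rᵗ
         in ⨾⁺ (m² X Y) (!R s&t) (l₁ ⊕ l₂) (m²⁺ X Y (↭-refl XY))
              (!R⁺ s&t (↭-refl XY) (PW.map (&R⁺ s t) (Pointwise-⊕ pw₁ pw₂))
                 (↭-trans XY' (⊕-↭ (web X') (web Y') n₁↭ n₂↭) (↭-sym XY' (m²⁻ X' Y' r₂))))
  from : (m² X Y ⨾ !R s&t) ∋ ((l₁ , l₂) , l) → (!s⊗!t ⨾ m² X' Y') ∋ ((l₁ , l₂) , l)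
  from r with _ , r₁ , r₂ ← ⨾⁻ (m² X Y) (!R s&t) r
         with n , pw , n↭l ← !R⁻ s&t r₂
         with n' , pw' , n'↭n ← ⟦⟧-↭ˡ s&t (↭-sym XY (m²⁻ X Y r₁)) pw
         with k₁ , k₂ , refl , pw₁ , pw₂ ← Pointwise-⊕⁻ˡ l₁ l₂ (PW.map (&R⁻ s t) pw') =
    ⨾⁺ !s⊗!t (m² X' Y') (k₁ , k₂)
       (⊗R⁺ (!R s) (!R t) (!R⁺ s (↭-refl (web X)) pw₁ (↭-refl (web X')))
                          (!R⁺ t (↭-refl (web Y)) pw₂ (↭-refl (web Y'))))
       (m²⁺ X' Y' (↭-sym XY' (↭-trans XY' n'↭n n↭l)))

module _ (X Y Z : PreNUTS) where
  private
    XY : Web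
    XY = web X ⊎w web Y
    YZ : Web
    YZ = web Y ⊎w web Z
    X[YZ] : Web
    X[YZ] = web X ⊎w YZ
    [XY]Z : Web
    [XY]Z = XY ⊎w web Z
    id⊗m² : Rel (! X ⊗ (! Y ⊗ ! Z)) (! X ⊗ ! (Y & Z))
    id⊗m² = _⊗R_ { ! X} { ! X} { ! Y ⊗ ! Z} { ! (Y & Z)} (idR (! X)) (m² Y Z)
    m²⊗id : Rel ((! X ⊗ ! Y) ⊗ ! Z) (! (X & Y) ⊗ ! Z)
    m²⊗id = _⊗R_ { ! X ⊗ ! Y} { ! (X & Y)} { ! Z} { ! Z} (m² X Y) (idR (! Z))

  m²-assocˡ⁻ : ∀ {l₁ l₂ l₃ L} → (α⊗ (! X) (! Y) (! Z) ⨾ id⊗m² ⨾ m² X (Y & Z)) ∋ (((l₁ , l₂) , l₃) , L) →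
               L ↭[ X[YZ] ] (l₁ ⊕ (l₂ ⊕ l₃))
  m²-assocˡ⁻ r =
    let (_ , r₁ , r₂) = ⨾⁻ (α⊗ (! X) (! Y) (! Z) ⨾ id⊗m²) (m² X (Y & Z)) r
        (_ , r₁₁ , r₁₂) = ⨾⁻ (α⊗ (! X) (! Y) (! Z)) id⊗m² r₁
        (l₁↭ , l₂↭ , l₃↭) = α⊗⁻ (! X) (! Y) (! Z) r₁₁
        (r-id , r-m²) = ⊗R⁻ (idR (! X)) (m² Y Z) r₁₂
    in ↭-trans X[YZ] (m²⁻ X (Y & Z) r₂)
         (⊕-↭ (web X) YZ (↭-sym (web X) (↭-trans (web X) l₁↭ (idR⁻ (! X) r-id)))
           (↭-trans YZ (m²⁻ Y Z r-m²) (⊕-↭ (web Y) (web Z) (↭-sym (web Y) l₂↭) (↭-sym (web Z) l₃↭))))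

  m²-assocˡ⁺ : ∀ {l₁ l₂ l₃ L} → L ↭[ X[YZ] ] (l₁ ⊕ (l₂ ⊕ l₃)) →
               (α⊗ (! X) (! Y) (! Z) ⨾ id⊗m² ⨾ m² X (Y & Z)) ∋ (((l₁ , l₂) , l₃) , L)
  m²-assocˡ⁺ {l₁} {l₂} {l₃} L↭ =
    ⨾⁺ (α⊗ (! X) (! Y) (! Z) ⨾ id⊗m²) (m² X (Y & Z)) (l₁ , l₂ ⊕ l₃)
      (⨾⁺ (α⊗ (! X) (! Y) (! Z)) id⊗m² (l₁ , (l₂ , l₃)) (α⊗⁺ (! X) (! Y) (! Z))
        (⊗R⁺ (idR (! X)) (m² Y Z) (idR⁺ (! X) (↭-refl (web X))) (m²⁺ Y Z (↭-refl YZ))))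
      (m²⁺ X (Y & Z) L↭)

  m²-assocʳ⁻ : ∀ {l₁ l₂ l₃ L} → (m²⊗id ⨾ m² (X & Y) Z ⨾ !R (α& X Y Z)) ∋ (((l₁ , l₂) , l₃) , L) →
               L ↭[ X[YZ] ] (l₁ ⊕ (l₂ ⊕ l₃))
  m²-assocʳ⁻ {l₁} {l₂} {l₃} r =
    let (_ , r₁ , r₂) = ⨾⁻ (m²⊗id ⨾ m² (X & Y) Z) (!R (α& X Y Z)) r
        (_ , r₁₁ , r₁₂) = ⨾⁻ m²⊗id (m² (X & Y) Z) r₁
        (r-m² , r-id) = ⊗R⁻ (m² X Y) (idR (! Z)) r₁₁
    in map-↭⁻ X[YZ] [XY]Z assocˡ assocʳ (assocʳ-cong (web X) (web Y) (web Z)) assocʳ-assocˡ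
         (P.subst (Permutation [XY]Z (map assocˡ _)) (P.sym (assocˡ-⊕ l₁ l₂ l₃))
           (↭-trans [XY]Z (↭-sym [XY]Z (!R-converse⁻ (α&-converse X Y Z) r₂))
             (↭-trans [XY]Z (m²⁻ (X & Y) Z r₁₂)
               (⊕-↭ XY (web Z) (m²⁻ X Y r-m²) (↭-sym (web Z) (idR⁻ (! Z) r-id))))))

  m²-assocʳ⁺ : ∀ {l₁ l₂ l₃ L} → L ↭[ X[YZ] ] (l₁ ⊕ (l₂ ⊕ l₃)) →
               (m²⊗id ⨾ m² (X & Y) Z ⨾ !R (α& X Y Z)) ∋ (((l₁ , l₂) , l₃) , L)
  m²-assocʳ⁺ {l₁} {l₂} {l₃} L↭ =
    ⨾⁺ (m²⊗id ⨾ m² (X & Y) Z) (!R (α& X Y Z)) ((l₁ ⊕ l₂) ⊕ l₃)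
      (⨾⁺ m²⊗id (m² (X & Y) Z) (l₁ ⊕ l₂ , l₃)
        (⊗R⁺ (m² X Y) (idR (! Z)) (m²⁺ X Y (↭-refl XY)) (idR⁺ (! Z) (↭-refl (web Z))))
        (m²⁺ (X & Y) Z (↭-refl [XY]Z)))
      (!R-converse⁺ (α&-converse X Y Z)
        (↭-sym [XY]Z (P.subst (Permutation [XY]Z _) (assocˡ-⊕ l₁ l₂ l₃) (map-↭ (α&-converse X Y Z) L↭))))

  m²-assoc : (α⊗ (! X) (! Y) (! Z) ⨾ id⊗m² ⨾ m² X (Y & Z)) ≗ (m²⊗id ⨾ m² (X & Y) Z ⨾ !R (α& X Y Z))
  m²-assoc _ = (λ r → m²-assocʳ⁺ (m²-assocˡ⁻ r)) , (λ r → m²-assocˡ⁺ (m²-assocʳ⁻ r))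

module _ (X : PreNUTS) where
  private
    A : Web
    A = web X
    ⊤A : Web
    ⊤A = emptyW ⊎w A
    A⊤ : Web
    A⊤ = A ⊎w emptyW
    m⁰⊗id : Rel (𝟏 ⊗ ! X) (! ⊤N ⊗ ! X)
    m⁰⊗id = _⊗R_ {𝟏} { ! ⊤N} { ! X} { ! X} m⁰ (idR (! X))
    id⊗m⁰ : Rel (! X ⊗ 𝟏) (! X ⊗ ! ⊤N)
    id⊗m⁰ = _⊗R_ { ! X} { ! X} {𝟏} { ! ⊤N} (idR (! X)) m⁰

  m²-unitˡ : (m⁰⊗id ⨾ m² ⊤N X ⨾ !R (λ& X)) ≗ λ⊗ (! X)
  m²-unitˡ ((_ , l) , l') = to , from
    where
    to : (m⁰⊗id ⨾ m² ⊤N X ⨾ !R (λ& X)) ∋ ((_ , l) , l') → λ⊗ (! X) ∋ ((_ , l) , l')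
    to r with _ , r₁ , r₂ ← ⨾⁻ (m⁰⊗id ⨾ m² ⊤N X) (!R (λ& X)) r
         with (k₀ , k) , r₁₁ , r₁₂ ← ⨾⁻ m⁰⊗id (m² ⊤N X) r₁
         with refl ← empty-list k₀ =
      λ⊗⁺ (! X) (↭-trans A (idR⁻ (! X) (proj₂ (⊗R⁻ m⁰ (idR (! X)) r₁₁)))
        (proj₂ (⊕-↭⁻ emptyW A {[]} {k} {[]} {l'}
          (↭-trans ⊤A (↭-sym ⊤A (m²⁻ ⊤N X r₁₂)) (!R-converse⁻ (π₂-converse {⊤N} {X}) r₂)))))
    from : λ⊗ (! X) ∋ ((_ , l) , l') → (m⁰⊗id ⨾ m² ⊤N X ⨾ !R (λ& X)) ∋ ((_ , l) , l')
    from r = ⨾⁺ (m⁰⊗id ⨾ m² ⊤N X) (!R (λ& X)) (map inj₂ l)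
               (⨾⁺ m⁰⊗id (m² ⊤N X) ([] , l) (⊗R⁺ m⁰ (idR (! X)) (m⁰⁺ []) (idR⁺ (! X) (↭-refl A)))
                 (m²⁺ ⊤N X (↭-refl ⊤A)))
               (!R-converse⁺ (π₂-converse {⊤N} {X}) (map-↭ (π₂-converse {⊤N} {X}) (λ⊗⁻ (! X) r)))

  m²-unitʳ : (id⊗m⁰ ⨾ m² X ⊤N ⨾ !R (ρ& X)) ≗ ρ⊗ (! X)
  m²-unitʳ ((l , _) , l') = to , from
    where
    to : (id⊗m⁰ ⨾ m² X ⊤N ⨾ !R (ρ& X)) ∋ ((l , _) , l') → ρ⊗ (! X) ∋ ((l , _) , l')
    to r with _ , r₁ , r₂ ← ⨾⁻ (id⊗m⁰ ⨾ m² X ⊤N) (!R (ρ& X)) r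
         with (k , k₀) , r₁₁ , r₁₂ ← ⨾⁻ id⊗m⁰ (m² X ⊤N) r₁
         with refl ← empty-list k₀ =
      ρ⊗⁺ (! X) (↭-trans A (idR⁻ (! X) (proj₁ (⊗R⁻ (idR (! X)) m⁰ r₁₁)))
        (proj₁ (⊕-↭⁻ A emptyW {k} {[]} {l'} {[]}
          (↭-trans A⊤ (↭-sym A⊤ (m²⁻ X ⊤N r₁₂))
            (↭-trans A⊤ (!R-converse⁻ (π₁-converse {X} {⊤N}) r₂)
              (↭-sym A⊤ (Permₚ.++-identityʳ A⊤ (map inj₁ l'))))))))
    from : ρ⊗ (! X) ∋ ((l , _) , l') → (id⊗m⁰ ⨾ m² X ⊤N ⨾ !R (ρ& X)) ∋ ((l , _) , l')
    from r = ⨾⁺ (id⊗m⁰ ⨾ m² X ⊤N) (!R (ρ& X)) (map inj₁ l)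
               (⨾⁺ id⊗m⁰ (m² X ⊤N) (l , []) (⊗R⁺ (idR (! X)) m⁰ (idR⁺ (! X) (↭-refl A)) (m⁰⁺ []))
                 (m²⁺ X ⊤N (↭-sym A⊤ (Permₚ.++-identityʳ A⊤ (map inj₁ l)))))
               (!R-converse⁺ (π₁-converse {X} {⊤N}) (map-↭ (π₁-converse {X} {⊤N}) (ρ⊗⁻ (! X) r)))

module _ (X Y : PreNUTS) where
  private
    XY : Web
    XY = web X ⊎w web Y
    YX : Web
    YX = web Y ⊎w web X

  m²-sym : (m² X Y ⨾ !R (σ& X Y)) ≗ (σ⊗ (! X) (! Y) ⨾ m² Y X)
  m²-sym ((l₁ , l₂) , L) = to , from
    where
    to : (m² X Y ⨾ !R (σ& X Y)) ∋ ((l₁ , l₂) , L) → (σ⊗ (! X) (! Y) ⨾ m² Y X) ∋ ((l₁ , l₂) , L)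
    to r = let (_ , r₁ , r₂) = ⨾⁻ (m² X Y) (!R (σ& X Y)) r
           in ⨾⁺ (σ⊗ (! X) (! Y)) (m² Y X) (l₂ , l₁) (σ⊗⁺ (! X) (! Y) (↭-refl (web X)) (↭-refl (web Y)))
                (m²⁺ Y X (map-↭⁻ YX XY swap swap (swap-cong (web X) (web Y)) swap-involutive
                  (↭-trans XY (↭-sym XY (!R-converse⁻ (σ&-converse X Y) r₂))
                    (↭-trans XY (m²⁻ X Y r₁) (↭-sym XY (swap-⊕-↭ (web X) (web Y) l₁ l₂))))))
    from : (σ⊗ (! X) (! Y) ⨾ m² Y X) ∋ ((l₁ , l₂) , L) → (m² X Y ⨾ !R (σ& X Y)) ∋ ((l₁ , l₂) , L)
    from r with (k₂ , k₁) , r₁ , r₂ ← ⨾⁻ (σ⊗ (! X) (! Y)) (m² Y X) r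
           with l₁↭k₁ , l₂↭k₂ ← σ⊗⁻ (! X) (! Y) r₁ =
      ⨾⁺ (m² X Y) (!R (σ& X Y)) (l₁ ⊕ l₂) (m²⁺ X Y (↭-refl XY))
        (!R-converse⁺ (σ&-converse X Y)
          (↭-sym XY (↭-trans XY (map-↭ (σ&-converse X Y) (m²⁻ Y X r₂))
            (↭-trans XY (swap-⊕-↭ (web X) (web Y) k₁ k₂)
              (⊕-↭ (web X) (web Y) (↭-sym (web X) l₁↭k₁) (↭-sym (web Y) l₂↭k₂))))))

module _ (X Y : PreNUTS) where
  private
    XY : Web
    XY = web X ⊎w web Y
    !π₁,!π₂ : Rel (! (X & Y)) (! X & ! Y)
    !π₁,!π₂ = ⟨_,_⟩ { ! (X & Y)} { ! X} { ! Y} (!R (π₁ {X} {Y})) (!R (π₂ {X} {Y}))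
    dig⊗dig : Rel (! X ⊗ ! Y) (! (! X) ⊗ ! (! Y))
    dig⊗dig = _⊗R_ { ! X} { ! (! X)} { ! Y} { ! (! Y)} (dig X) (dig Y)

  ⟨!π₁,!π₂⟩-converse : IsConverseOf !π₁,!π₂ embed
  ⟨!π₁,!π₂⟩-converse = record { h-cong = h-cong ; ∋⇒≈h = ∋⇒≈h ; h∋ = h∋ }
    where
    h-cong : ∀ {L L'} → Setoid._≈_ (MfinW (web X) ⊎w MfinW (web Y)) L L' → embed L ↭[ XY ] embed L'
    h-cong (⊎ₚ.inj₁ e) = map-↭ (π₁-converse {X} {Y}) e
    h-cong (⊎ₚ.inj₂ e) = map-↭ (π₂-converse {X} {Y}) e

    ∋⇒≈h : ∀ {l L} → !π₁,!π₂ ∋ (l , L) → l ↭[ XY ] embed L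
    ∋⇒≈h {L = inj₁ _} r = !R-converse⁻ (π₁-converse {X} {Y}) (⟨,⟩⁻₁ (!R (π₁ {X} {Y})) (!R (π₂ {X} {Y})) r)
    ∋⇒≈h {L = inj₂ _} r = !R-converse⁻ (π₂-converse {X} {Y}) (⟨,⟩⁻₂ (!R (π₁ {X} {Y})) (!R (π₂ {X} {Y})) r)

    h∋ : ∀ L → !π₁,!π₂ ∋ (embed L , L)
    h∋ (inj₁ _) = ⟨,⟩⁺₁ (!R (π₁ {X} {Y})) (!R (π₂ {X} {Y})) (!R-converse⁺ (π₁-converse {X} {Y}) (↭-refl XY))
    h∋ (inj₂ _) = ⟨,⟩⁺₂ (!R (π₁ {X} {Y})) (!R (π₂ {X} {Y})) (!R-converse⁺ (π₂-converse {X} {Y}) (↭-refl XY))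

  m²-dig : (m² X Y ⨾ dig (X & Y) ⨾ !R !π₁,!π₂) ≗ (dig⊗dig ⨾ m² (! X) (! Y))
  m²-dig ((l₁ , l₂) , 𝕃) = to , from
    where
    to : (m² X Y ⨾ dig (X & Y) ⨾ !R !π₁,!π₂) ∋ ((l₁ , l₂) , 𝕃) → (dig⊗dig ⨾ m² (! X) (! Y)) ∋ ((l₁ , l₂) , 𝕃)
    to r =
      let (M , r₁ , r₂) = ⨾⁻ (m² X Y ⨾ dig (X & Y)) (!R !π₁,!π₂) r
          (K , r₁₁ , r₁₂) = ⨾⁻ (m² X Y) (dig (X & Y)) r₁
          (l₁↭ , l₂↭) = ⊕-↭⁻ (web X) (web Y)
            (P.subst (Permutation XY (l₁ ⊕ l₂)) (concat-embed-⊕ (lefts 𝕃) (rights 𝕃))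
              (↭-trans XY (↭-sym XY (m²⁻ X Y r₁₁)) (↭-trans XY (dig⁻ (X & Y) r₁₂)
                (↭-concat XY (↭-trans (MfinW XY) (!R-converse⁻ ⟨!π₁,!π₂⟩-converse r₂)
                  (map-↭ ⟨!π₁,!π₂⟩-converse (↭-lefts⊕rights (MfinW (web X)) (MfinW (web Y)) 𝕃)))))))
      in ⨾⁺ dig⊗dig (m² (! X) (! Y)) (lefts 𝕃 , rights 𝕃) (⊗R⁺ (dig X) (dig Y) (dig⁺ X l₁↭) (dig⁺ Y l₂↭))
           (m²⁺ (! X) (! Y) (↭-lefts⊕rights (MfinW (web X)) (MfinW (web Y)) 𝕃))
    from : (dig⊗dig ⨾ m² (! X) (! Y)) ∋ ((l₁ , l₂) , 𝕃) → (m² X Y ⨾ dig (X & Y) ⨾ !R !π₁,!π₂) ∋ ((l₁ , l₂) , 𝕃)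
    from r =
      let ((L₁ , L₂) , r₁ , r₂) = ⨾⁻ dig⊗dig (m² (! X) (! Y)) r
          (d₁ , d₂) = ⊗R⁻ (dig X) (dig Y) r₁
      in ⨾⁺ (m² X Y ⨾ dig (X & Y)) (!R !π₁,!π₂) (map embed 𝕃)
           (⨾⁺ (m² X Y) (dig (X & Y)) (l₁ ⊕ l₂) (m²⁺ X Y (↭-refl XY))
             (dig⁺ (X & Y) (↭-trans XY (⊕-↭ (web X) (web Y) (dig⁻ X d₁) (dig⁻ Y d₂))
               (P.subst (λ l → l ↭[ XY ] concat (map embed 𝕃)) (concat-embed-⊕ L₁ L₂)
                 (↭-concat XY (map-↭ ⟨!π₁,!π₂⟩-converse
                   (↭-sym (MfinW (web X) ⊎w MfinW (web Y)) (m²⁻ (! X) (! Y) r₂))))))))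
           (!R-converse⁺ ⟨!π₁,!π₂⟩-converse (↭-refl (MfinW XY)))

lemma4p10 : SeelyStructure
lemma4p10 = record
  { !-hom        = !R-Hom
  ; !-id         = λ X → !R-id (proj₁ X)
  ; !-comp       = λ _ _ _ s t _ _ → !R-⨾ s t
  ; der-hom      = λ X → der-Hom (proj₁ X)
  ; dig-hom      = λ X → dig-Hom (proj₁ X)
  ; der-nat      = λ _ _ t _ → der-natural t
  ; dig-nat      = λ _ _ t _ → dig-natural t
  ; comonad-der₁ = λ X → dig⨾der (proj₁ X)
  ; comonad-der₂ = λ X → dig⨾!der (proj₁ X)
  ; comonad-dig  = λ X → dig⨾dig (proj₁ X)
  ; m⁰-hom       = m⁰-Hom
  ; m⁰-iso       = m⁰-IsIso
  ; m²-hom       = m²-Hom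
  ; m²-iso       = λ X Y → m²-IsIso (proj₁ X) (proj₁ Y)
  ; m²-nat       = λ _ _ _ _ s t _ _ → m²-natural s t
  ; m²-assoc     = λ X Y Z → m²-assoc (proj₁ X) (proj₁ Y) (proj₁ Z)
  ; m²-unitˡ     = λ X → m²-unitˡ (proj₁ X)
  ; m²-unitʳ     = λ X → m²-unitʳ (proj₁ X)
  ; m²-sym       = λ X Y → m²-sym (proj₁ X) (proj₁ Y)
  ; seely-dig    = λ X Y → m²-dig (proj₁ X) (proj₁ Y)
  }
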